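{- For $n\ge1$ let $t_n(u)=\sum_{D}u^{\operatorname{des}(D)}$, the sum over all strongly connected tournaments $D$ on $[n]$. Let \[T(x)=\sum_{n=1}^\infty t_n(u)\frac{x^n}{n!_u},\qquad U(x)=\sum_{n=0}^\infty (1+u)^{\binom n2}\frac{x^n}{n!_u},\] as formal power series in $x$ with coefficients in $\mathbb{Q}(u)$. Then $T(x)=1-U(x)^{ -1}$ and $U(x)=\dfrac{1}{1-T(x)}$.
   Context: A digraph on a finite set $V$ of integers is a set of ordered pairs $(s,t)\in V\times V$ with $s\ne t$. A tournament is a digraph with exactly one of $(s,t)$, $(t,s)$ as an edge for each pair $s\neq t$. A digraph is strongly connected if for every two vertices $a,b$ there is a directed path from $a$ to $b$ (the empty path allowed when $a=b$). A descent of a digraph is an edge $(s,t)$ with $s>t$; $\operatorname{des}(D)$ is the number of descents. The $u$-factorial is $n!_u=\prod_{j=1}^n(1+u+\cdots+u^{j-1})$ (with $0!_u=1$). -}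

module Defs where

open import Data.Bool using (Bool; true; false; _∧_; if_then_else_)
open import Data.Nat as ℕ using (ℕ; zero; suc; _<ᵇ_)
open import Data.Nat.Combinatorics using (_C_)
open import Data.Integer as ℤ using (ℤ; +_; 0ℤ; 1ℤ)
open import Data.List using (List; []; _∷_; _++_; foldr; map; upTo; replicate; concatMap; allFin)
open import Data.Nat.ListAction using (sum)
open import Data.Fin using (Fin; toℕ)
open import Data.Vec using (Vec; lookup)
open import Data.Product using (_×_; _,_)
open import Data.Sum using (_⊎_)
open import Data.List.Membership.Propositional using (_∈_)
open import Data.List.Relation.Unary.Unique.Propositional using (Unique)
open import Relation.Binary.PropositionalEquality using (_≡_; _≢_)
open import Relation.Nullary using (¬_)
open import Function.Bundles using (_⇔_)

-- Digraphs on [n]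
-- The vertex set [n] = {1,…,n} is represented by Fin n, with the
-- (order-preserving) identification i ↦ toℕ i + 1; so descents are the
-- same.

Digraph : ℕ → Set
Digraph n = Vec (Vec Bool n) n

Edge : ∀ {n} → Digraph n → Fin n → Fin n → Set
Edge D s t = lookup (lookup D s) t ≡ true

IsTournament : ∀ {n} → Digraph n → Set
IsTournament {n} D =
  (∀ s → ¬ Edge D s s) ×
  (∀ s t → s ≢ t → Edge D s t ⊎ Edge D t s) ×
  (∀ s t → Edge D s t → ¬ Edge D t s)

data Path {n} (D : Digraph n) : Fin n → Fin n → Set where
  here : ∀ {a} → Path D a a
  step : ∀ {a b c} → Edge D a b → Path D b c → Path D a c

StronglyConnected : ∀ {n} → Digraph n → Set
StronglyConnected D = ∀ a b → Path D a b

des : ∀ {n} → Digraph n → ℕ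
des {n} D = sum (concatMap (λ s → map (λ t → count s t) (allFin n)) (allFin n))
  where
  count : Fin n → Fin n → ℕ
  count s t = if lookup (lookup D s) t ∧ (toℕ t <ᵇ toℕ s) then 1 else 0

-- Polynomials in u over ℤ: coefficient lists, lowest degree first.

Poly : Set
Poly = List ℤ

coeff : Poly → ℕ → ℤ
coeff []       _       = 0ℤ
coeff (a ∷ p)  zero    = a
coeff (a ∷ p)  (suc i) = coeff p i

_≈P_ : Poly → Poly → Set
p ≈P q = ∀ i → coeff p i ≡ coeff q i

_+P_ : Poly → Poly → Poly
[]      +P q       = q
(a ∷ p) +P []      = a ∷ p
(a ∷ p) +P (b ∷ q) = (a ℤ.+ b) ∷ (p +P q)

-P_ : Poly → Poly
-P p = map ℤ.-_ p

scale : ℤ → Poly → Poly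
scale a = map (a ℤ.*_)

_*P_ : Poly → Poly → Poly
[]      *P q = []
(a ∷ p) *P q = scale a q +P (0ℤ ∷ (p *P q))

constP : ℤ → Poly
constP a = a ∷ []

monomial : ℕ → Poly
monomial k = replicate k 0ℤ ++ (1ℤ ∷ [])

_^P_ : Poly → ℕ → Poly
p ^P zero  = constP 1ℤ
p ^P suc k = p *P (p ^P k)

uInt : ℕ → Poly
uInt j = replicate j 1ℤ

_!u : ℕ → Poly
zero  !u = constP 1ℤ
suc n !u = uInt (suc n) *P (n !u)

-- Elements of ℚ(u) = Frac(ℤ[u]) as fractions num/den (all denominators
-- occurring below are products of u-factorials, hence nonzero);
-- equality by cross-multiplication.

record Frac : Set where
  constructor _/_
  field
    num : Poly
    den : Poly
open Frac public

_≈F_ : Frac → Frac → Set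
(a / b) ≈F (c / d) = (a *P d) ≈P (c *P b)

_+F_ : Frac → Frac → Frac
(a / b) +F (c / d) = ((a *P d) +P (c *P b)) / (b *P d)

_*F_ : Frac → Frac → Frac
(a / b) *F (c / d) = (a *P c) / (b *P d)

-F_ : Frac → Frac
-F (a / b) = (-P a) / b

0F 1F : Frac
0F = [] / constP 1ℤ
1F = constP 1ℤ / constP 1ℤ

Series : Set
Series = ℕ → Frac

_≈S_ : Series → Series → Set
f ≈S g = ∀ n → f n ≈F g n

sumF : List Frac → Frac
sumF = foldr _+F_ 0F

_*S_ : Series → Series → Series
(f *S g) n = sumF (map (λ k → f k *F g (n ℕ.∸ k)) (upTo (suc n)))

_-S_ : Series → Series → Series
(f -S g) n = f n +F (-F g n)

1S : Series
1S zero    = 1F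
1S (suc n) = 0F

IsInverse : Series → Series → Set
IsInverse f g = ((f *S g) ≈S 1S) × ((g *S f) ≈S 1S)

U : Series
U n = ((constP 1ℤ +P monomial 1) ^P (n C 2)) / (n !u)

tpoly : ∀ {n} → List (Digraph n) → Poly
tpoly = foldr (λ D acc → monomial (des D) +P acc) []

-- Given an enumeration L n of the strongly connected tournaments on [n],
-- T(x) = Σ_{n≥1} t_n(u) x^n / n!_u
T : ((n : ℕ) → List (Digraph n)) → Series
T L zero    = 0F
T L (suc n) = tpoly (L (suc n)) / (suc n !u)

EnumeratesSCT : ((n : ℕ) → List (Digraph n)) → Set
EnumeratesSCT L =
  (∀ n → Unique (L n)) ×
  (∀ n (D : Digraph n) → (D ∈ L n) ⇔ (IsTournament D × StronglyConnected D))

-- A tournament D on n ≥ 1 vertices has a top strong component S: a nonempty set inducing a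
-- strongly connected tournament that beats every vertex outside it. Conversely, any strongly
-- connected tournament on a k-set S merged with any tournament on the complement in this way
-- is a tournament with top component S, so tournaments on [n] correspond bijectively to
-- triples (S, strongly connected tournament on S, tournament on the complement). A descent of
-- the merge is a descent of one of the two pieces or a pair (s ∈ S, t ∉ S) with t < s, and
-- summing u^(number of such pairs) over all k-subsets S gives the u-binomial [n k]_u.
-- Since summing u^des over all tournaments on [m] gives (1+u)^C(m,2),
--   (1+u)^C(n,2) = Σ_{k=1}^n [n k]_u t_k(u) (1+u)^C(n-k,2)   for n ≥ 1,
-- and [n k]_u k!_u (n-k)!_u = n!_u turns this into the coefficientwise form of (1 - T) U = 1;
-- the symmetry [n k]_u = [n n-k]_u gives U (1 - T) = 1 as well.

module Submission where

open import Algebra.Bundles using (CommutativeRing)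
open import Data.Bool as Bool using (Bool; true; false; not; _∧_; if_then_else_)
import Data.Bool.Properties as Bool
open import Data.Empty using (⊥; ⊥-elim)
open import Data.Fin as Fin using (Fin; toℕ)
import Data.Fin.Properties as Fin
open import Data.Integer as ℤ using (ℤ; 0ℤ; 1ℤ)
import Data.Integer.Properties as ℤ
open import Data.List as List using (List; []; _∷_; map; _++_; concatMap; foldr; allFin; upTo)
import Data.List.Properties as List
open import Data.List.Membership.Propositional using (_∈_)
open import Data.List.Membership.Propositional.Properties
  using (∈-++⁺ˡ; ∈-++⁺ʳ; ∈-map⁺; ∈-map⁻; ∈-concat⁺′; ∈-concat⁻′; ∈-upTo⁺; ∈-upTo⁻)
open import Data.List.Membership.Propositional.Properties.WithK using (unique∧set⇒bag)
import Data.List.Membership.DecPropositional as DecMembership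
open import Data.List.Relation.Binary.BagAndSetEquality using (∼bag⇒↭)
open import Data.List.Relation.Binary.Permutation.Propositional as ↭ using (_↭_)
import Data.List.Relation.Unary.All as All
import Data.List.Relation.Unary.AllPairs as AllPairs
open import Data.List.Relation.Unary.Any using (here; there)
open import Data.List.Relation.Unary.Unique.Propositional using (Unique)
open import Data.List.Relation.Unary.Unique.Propositional.Properties using (++⁺; map⁺; upTo⁺)
open import Data.Maybe using (nothing)
open import Data.Nat as ℕ using (ℕ; zero; suc; _≤_; _∸_; s≤s)
open import Data.Nat.Combinatorics using (_C_; nC1≡n; nCk+nC[k+1]≡[n+1]C[k+1])
import Data.Nat.ListAction as ListAction
import Data.Nat.ListAction.Properties as ListAction
import Data.Nat.Properties as ℕ
open import Data.Product using (Σ; Σ-syntax; _×_; _,_; proj₁; proj₂)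
open import Data.Sum as Sum using (_⊎_; inj₁; inj₂)
import Data.Sum.Properties as Sum
open import Data.Vec as Vec using (Vec; lookup; tabulate)
import Data.Vec.Properties as Vec
open import Function using (_∘_)
open import Function.Bundles using (mk⇔; Equivalence)
open import Function.Definitions using (Injective)
open import Relation.Binary.Bundles using (Setoid)
open import Relation.Binary.PropositionalEquality
import Relation.Binary.Reasoning.Setoid as SetoidReasoning
open import Relation.Binary.Structures using (IsEquivalence)
open import Relation.Nullary using (¬_; Dec; yes; no; isYes)
open import Relation.Nullary.Decidable using (¬¬-excluded-middle)
open import Relation.Nullary.Negation using (¬¬-map)
open import Tactic.RingSolver using (solve-∀)
open import Tactic.RingSolver.Core.AlmostCommutativeRing using (AlmostCommutativeRing; fromCommutativeRing)

open import Defs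

open import Algebra.Properties.CommutativeMonoid.Sum ℕ.+-0-commutativeMonoid
  using (sum; sum-syntax; sum-cong-≗; ∑-distrib-+)
open import Algebra.Properties.CommutativeSemigroup ℕ.+-commutativeSemigroup using (x∙yz≈y∙xz)

-- The polynomial ring ℤ[u]

-- Wrapping _≈P_ in a record makes p and q inferable from a proof of p ≋ q.
infix 4 _≋_
record _≋_ (p q : Poly) : Set where
  constructor mk≋
  field coeff-≡ : p ≈P q
open _≋_

≋-refl : ∀ {p} → p ≋ p
≋-refl = mk≋ λ _ → refl

≋-sym : ∀ {p q} → p ≋ q → q ≋ p
≋-sym (mk≋ e) = mk≋ λ i → sym (e i)

≋-trans : ∀ {p q r} → p ≋ q → q ≋ r → p ≋ r
≋-trans (mk≋ e) (mk≋ f) = mk≋ λ i → trans (e i) (f i)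

≋-isEquivalence : IsEquivalence _≋_
≋-isEquivalence = record { refl = ≋-refl ; sym = ≋-sym ; trans = ≋-trans }

≋-setoid : Setoid _ _
≋-setoid = record { isEquivalence = ≋-isEquivalence }

module ≋-Reasoning = SetoidReasoning ≋-setoid

≡⇒≋ : ∀ {p q} → p ≡ q → p ≋ q
≡⇒≋ refl = ≋-refl

∷-cong : ∀ {a b p q} → a ≡ b → p ≋ q → (a ∷ p) ≋ (b ∷ q)
∷-cong a≡b (mk≋ e) = mk≋ λ where
  zero    → a≡b
  (suc i) → e i

∷-injectiveʳ : ∀ {a b p q} → (a ∷ p) ≋ (b ∷ q) → p ≋ q
∷-injectiveʳ (mk≋ e) = mk≋ λ i → e (suc i)

0∷-[] : ∀ {p} → p ≋ [] → (0ℤ ∷ p) ≋ []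
0∷-[] (mk≋ e) = mk≋ λ where
  zero    → refl
  (suc i) → e i

coeff-+P : ∀ p q i → coeff (p +P q) i ≡ coeff p i ℤ.+ coeff q i
coeff-+P []      q       i       = sym (ℤ.+-identityˡ _)
coeff-+P (a ∷ p) []      i       = sym (ℤ.+-identityʳ _)
coeff-+P (a ∷ p) (b ∷ q) zero    = refl
coeff-+P (a ∷ p) (b ∷ q) (suc i) = coeff-+P p q i

coeff-scale : ∀ a p i → coeff (scale a p) i ≡ a ℤ.* coeff p i
coeff-scale a []      i       = sym (ℤ.*-zeroʳ a)
coeff-scale a (x ∷ p) zero    = refl
coeff-scale a (x ∷ p) (suc i) = coeff-scale a p i

coeff--P : ∀ p i → coeff (-P p) i ≡ ℤ.- coeff p i
coeff--P []      i       = refl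
coeff--P (x ∷ p) zero    = refl
coeff--P (x ∷ p) (suc i) = coeff--P p i

+P-cong : ∀ {p p′ q q′} → p ≋ p′ → q ≋ q′ → (p +P q) ≋ (p′ +P q′)
+P-cong {p} {p′} {q} {q′} (mk≋ e) (mk≋ f) = mk≋ λ i →
  trans (coeff-+P p q i) (trans (cong₂ ℤ._+_ (e i) (f i)) (sym (coeff-+P p′ q′ i)))

+P-congˡ : ∀ {p p′} q → p ≋ p′ → (p +P q) ≋ (p′ +P q)
+P-congˡ q e = +P-cong e ≋-refl

+P-congʳ : ∀ p {q q′} → q ≋ q′ → (p +P q) ≋ (p +P q′)
+P-congʳ p e = +P-cong ≋-refl e

+P-comm : ∀ p q → (p +P q) ≋ (q +P p)
+P-comm p q = mk≋ λ i →
  trans (coeff-+P p q i) (trans (ℤ.+-comm (coeff p i) (coeff q i)) (sym (coeff-+P q p i)))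

+P-assoc : ∀ p q r → ((p +P q) +P r) ≋ (p +P (q +P r))
+P-assoc p q r = mk≋ λ i → begin
  coeff ((p +P q) +P r) i                  ≡⟨ coeff-+P (p +P q) r i ⟩
  coeff (p +P q) i ℤ.+ coeff r i           ≡⟨ cong (ℤ._+ coeff r i) (coeff-+P p q i) ⟩
  (coeff p i ℤ.+ coeff q i) ℤ.+ coeff r i  ≡⟨ ℤ.+-assoc (coeff p i) _ _ ⟩
  coeff p i ℤ.+ (coeff q i ℤ.+ coeff r i)  ≡⟨ cong (λ x → coeff p i ℤ.+ x) (coeff-+P q r i) ⟨
  coeff p i ℤ.+ coeff (q +P r) i           ≡⟨ coeff-+P p (q +P r) i ⟨
  coeff (p +P (q +P r)) i                  ∎
  where open ≡-Reasoning

+P-identityʳ : ∀ p → (p +P []) ≋ p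
+P-identityʳ p = mk≋ λ i → trans (coeff-+P p [] i) (ℤ.+-identityʳ _)

+P-interchange : ∀ a b c d → ((a +P b) +P (c +P d)) ≋ ((a +P c) +P (b +P d))
+P-interchange a b c d = begin
  (a +P b) +P (c +P d)  ≈⟨ +P-assoc a b (c +P d) ⟩
  a +P (b +P (c +P d))  ≈⟨ +P-congʳ a (≋-sym (+P-assoc b c d)) ⟩
  a +P ((b +P c) +P d)  ≈⟨ +P-congʳ a (+P-congˡ d (+P-comm b c)) ⟩
  a +P ((c +P b) +P d)  ≈⟨ +P-congʳ a (+P-assoc c b d) ⟩
  a +P (c +P (b +P d))  ≈⟨ ≋-sym (+P-assoc a c (b +P d)) ⟩
  (a +P c) +P (b +P d)  ∎
  where open ≋-Reasoning

-P-cong : ∀ {p q} → p ≋ q → (-P p) ≋ (-P q)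
-P-cong {p} {q} (mk≋ e) = mk≋ λ i → trans (coeff--P p i) (trans (cong ℤ.-_ (e i)) (sym (coeff--P q i)))

-P-inverseˡ : ∀ p → ((-P p) +P p) ≋ []
-P-inverseˡ p = mk≋ λ i →
  trans (coeff-+P (-P p) p i) (trans (cong (ℤ._+ coeff p i) (coeff--P p i)) (ℤ.+-inverseˡ (coeff p i)))

-P-inverseʳ : ∀ p → (p +P (-P p)) ≋ []
-P-inverseʳ p = ≋-trans (+P-comm p (-P p)) (-P-inverseˡ p)

scale-cong : ∀ a {p q} → p ≋ q → scale a p ≋ scale a q
scale-cong a {p} {q} (mk≋ e) = mk≋ λ i →
  trans (coeff-scale a p i) (trans (cong (a ℤ.*_) (e i)) (sym (coeff-scale a q i)))

scale-zero : ∀ p → scale 0ℤ p ≋ []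
scale-zero p = mk≋ λ i → trans (coeff-scale 0ℤ p i) (ℤ.*-zeroˡ (coeff p i))

scale-one : ∀ p → scale 1ℤ p ≋ p
scale-one p = mk≋ λ i → trans (coeff-scale 1ℤ p i) (ℤ.*-identityˡ _)

scale-distribˡ : ∀ a p q → scale a (p +P q) ≋ (scale a p +P scale a q)
scale-distribˡ a p q = mk≋ λ i → begin
  coeff (scale a (p +P q)) i                   ≡⟨ coeff-scale a (p +P q) i ⟩
  a ℤ.* coeff (p +P q) i                       ≡⟨ cong (a ℤ.*_) (coeff-+P p q i) ⟩
  a ℤ.* (coeff p i ℤ.+ coeff q i)              ≡⟨ ℤ.*-distribˡ-+ a _ _ ⟩
  a ℤ.* coeff p i ℤ.+ a ℤ.* coeff q i          ≡⟨ cong₂ ℤ._+_ (coeff-scale a p i) (coeff-scale a q i) ⟨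
  coeff (scale a p) i ℤ.+ coeff (scale a q) i  ≡⟨ coeff-+P (scale a p) (scale a q) i ⟨
  coeff (scale a p +P scale a q) i             ∎
  where open ≡-Reasoning

scale-distribʳ : ∀ a b p → scale (a ℤ.+ b) p ≋ (scale a p +P scale b p)
scale-distribʳ a b p = mk≋ λ i → begin
  coeff (scale (a ℤ.+ b) p) i                  ≡⟨ coeff-scale (a ℤ.+ b) p i ⟩
  (a ℤ.+ b) ℤ.* coeff p i                      ≡⟨ ℤ.*-distribʳ-+ (coeff p i) a b ⟩
  a ℤ.* coeff p i ℤ.+ b ℤ.* coeff p i          ≡⟨ cong₂ ℤ._+_ (coeff-scale a p i) (coeff-scale b p i) ⟨
  coeff (scale a p) i ℤ.+ coeff (scale b p) i  ≡⟨ coeff-+P (scale a p) (scale b p) i ⟨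
  coeff (scale a p +P scale b p) i             ∎
  where open ≡-Reasoning

scale-scale : ∀ a b p → scale a (scale b p) ≋ scale (a ℤ.* b) p
scale-scale a b p = mk≋ λ i → begin
  coeff (scale a (scale b p)) i  ≡⟨ coeff-scale a (scale b p) i ⟩
  a ℤ.* coeff (scale b p) i      ≡⟨ cong (a ℤ.*_) (coeff-scale b p i) ⟩
  a ℤ.* (b ℤ.* coeff p i)        ≡⟨ ℤ.*-assoc a b _ ⟨
  (a ℤ.* b) ℤ.* coeff p i        ≡⟨ coeff-scale (a ℤ.* b) p i ⟨
  coeff (scale (a ℤ.* b) p) i    ∎
  where open ≡-Reasoning

0∷-*P : ∀ p q → ((0ℤ ∷ p) *P q) ≋ (0ℤ ∷ (p *P q))
0∷-*P p q = +P-congˡ (0ℤ ∷ (p *P q)) (scale-zero q)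

*P-zeroʳ : ∀ p → (p *P []) ≋ []
*P-zeroʳ []      = ≋-refl
*P-zeroʳ (a ∷ p) = 0∷-[] (*P-zeroʳ p)

*P-congʳ : ∀ p {q q′} → q ≋ q′ → (p *P q) ≋ (p *P q′)
*P-congʳ []      e = ≋-refl
*P-congʳ (a ∷ p) e = +P-cong (scale-cong a e) (∷-cong refl (*P-congʳ p e))

*P-distribʳ : ∀ p p′ q → ((p +P p′) *P q) ≋ ((p *P q) +P (p′ *P q))
*P-distribʳ []      p′       q = ≋-refl
*P-distribʳ (a ∷ p) []       q = ≋-sym (+P-identityʳ _)
*P-distribʳ (a ∷ p) (b ∷ p′) q = begin
  scale (a ℤ.+ b) q +P (0ℤ ∷ ((p +P p′) *P q))
    ≈⟨ +P-cong (scale-distribʳ a b q) (∷-cong refl (*P-distribʳ p p′ q)) ⟩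
  (scale a q +P scale b q) +P ((0ℤ ∷ (p *P q)) +P (0ℤ ∷ (p′ *P q)))
    ≈⟨ +P-interchange (scale a q) (scale b q) (0ℤ ∷ (p *P q)) (0ℤ ∷ (p′ *P q)) ⟩
  ((a ∷ p) *P q) +P ((b ∷ p′) *P q)
    ∎
  where open ≋-Reasoning

*P-∷ʳ : ∀ p b q → (p *P (b ∷ q)) ≋ (scale b p +P (0ℤ ∷ (p *P q)))
*P-∷ʳ []      b q = ≋-sym (0∷-[] ≋-refl)
*P-∷ʳ (a ∷ p) b q = ∷-cong (cong (ℤ._+ 0ℤ) (ℤ.*-comm a b)) (begin
  scale a q +P (p *P (b ∷ q))                      ≈⟨ +P-congʳ (scale a q) (*P-∷ʳ p b q) ⟩
  scale a q +P (scale b p +P (0ℤ ∷ (p *P q)))      ≈⟨ ≋-sym (+P-assoc (scale a q) (scale b p) _) ⟩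
  (scale a q +P scale b p) +P (0ℤ ∷ (p *P q))      ≈⟨ +P-congˡ (0ℤ ∷ (p *P q)) (+P-comm (scale a q) (scale b p)) ⟩
  (scale b p +P scale a q) +P (0ℤ ∷ (p *P q))      ≈⟨ +P-assoc (scale b p) (scale a q) _ ⟩
  scale b p +P ((a ∷ p) *P q)                      ∎)
  where open ≋-Reasoning

*P-comm : ∀ p q → (p *P q) ≋ (q *P p)
*P-comm []      q = ≋-sym (*P-zeroʳ q)
*P-comm (a ∷ p) q = ≋-trans (+P-congʳ (scale a q) (∷-cong refl (*P-comm p q))) (≋-sym (*P-∷ʳ q a p))

*P-congˡ : ∀ {p p′} q → p ≋ p′ → (p *P q) ≋ (p′ *P q)
*P-congˡ {p} {p′} q e = ≋-trans (*P-comm p q) (≋-trans (*P-congʳ q e) (*P-comm q p′))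

*P-cong : ∀ {p p′ q q′} → p ≋ p′ → q ≋ q′ → (p *P q) ≋ (p′ *P q′)
*P-cong {p′ = p′} {q = q} e f = ≋-trans (*P-congˡ q e) (*P-congʳ p′ f)

scale-*P : ∀ a p q → (scale a p *P q) ≋ scale a (p *P q)
scale-*P a []      q = ≋-refl
scale-*P a (b ∷ p) q = begin
  scale (a ℤ.* b) q +P (0ℤ ∷ (scale a p *P q))   ≈⟨ +P-cong (≋-sym (scale-scale a b q)) (∷-cong (sym (ℤ.*-zeroʳ a)) (scale-*P a p q)) ⟩
  scale a (scale b q) +P scale a (0ℤ ∷ (p *P q)) ≈⟨ scale-distribˡ a (scale b q) (0ℤ ∷ (p *P q)) ⟨
  scale a ((b ∷ p) *P q)                          ∎
  where open ≋-Reasoning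

*P-assoc : ∀ p q r → ((p *P q) *P r) ≋ (p *P (q *P r))
*P-assoc []      q r = ≋-refl
*P-assoc (a ∷ p) q r = begin
  (scale a q +P (0ℤ ∷ (p *P q))) *P r        ≈⟨ *P-distribʳ (scale a q) _ r ⟩
  (scale a q *P r) +P ((0ℤ ∷ (p *P q)) *P r) ≈⟨ +P-cong (scale-*P a q r) (0∷-*P (p *P q) r) ⟩
  scale a (q *P r) +P (0ℤ ∷ ((p *P q) *P r)) ≈⟨ +P-congʳ (scale a (q *P r)) (∷-cong refl (*P-assoc p q r)) ⟩
  (a ∷ p) *P (q *P r)                        ∎
  where open ≋-Reasoning

*P-distribˡ : ∀ p q q′ → (p *P (q +P q′)) ≋ ((p *P q) +P (p *P q′))
*P-distribˡ p q q′ =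
  ≋-trans (*P-comm p _) (≋-trans (*P-distribʳ q q′ p) (+P-cong (*P-comm q p) (*P-comm q′ p)))

1P : Poly
1P = constP 1ℤ

*P-identityˡ : ∀ p → (1P *P p) ≋ p
*P-identityˡ p = ≋-trans (+P-cong (scale-one p) (0∷-[] ≋-refl)) (+P-identityʳ p)

*P-identityʳ : ∀ p → (p *P 1P) ≋ p
*P-identityʳ p = ≋-trans (*P-comm p 1P) (*P-identityˡ p)

ℤ[u] : CommutativeRing _ _
ℤ[u] = record
  { Carrier = Poly ; _≈_ = _≋_ ; _+_ = _+P_ ; _*_ = _*P_ ; -_ = -P_ ; 0# = [] ; 1# = 1P
  ; isCommutativeRing = record
    { isRing = record
      { +-isAbelianGroup = record
        { isGroup = record
          { isMonoid = record
            { isSemigroup = record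
              { isMagma = record { isEquivalence = ≋-isEquivalence ; ∙-cong = +P-cong }
              ; assoc = +P-assoc }
            ; identity = (λ _ → ≋-refl) , +P-identityʳ }
          ; inverse = -P-inverseˡ , -P-inverseʳ
          ; ⁻¹-cong = -P-cong }
        ; comm = +P-comm }
      ; *-cong = *P-cong
      ; *-assoc = *P-assoc
      ; *-identity = *P-identityˡ , *P-identityʳ
      ; distrib = *P-distribˡ , λ q p p′ → *P-distribʳ p p′ q }
    ; *-comm = *P-comm } }

ℤ[u]-solver : AlmostCommutativeRing _ _
ℤ[u]-solver = fromCommutativeRing ℤ[u] (λ _ → nothing)

ΣP : ∀ {A : Set} → List A → (A → Poly) → Poly
ΣP xs f = foldr (λ x acc → f x +P acc) [] xs

ΣP-cong : ∀ {A : Set} (xs : List A) {f g : A → Poly} → (∀ x → x ∈ xs → f x ≋ g x) → ΣP xs f ≋ ΣP xs g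
ΣP-cong []       f≋g = ≋-refl
ΣP-cong (x ∷ xs) f≋g = +P-cong (f≋g x (here refl)) (ΣP-cong xs λ y y∈xs → f≋g y (there y∈xs))

ΣP-++ : ∀ {A : Set} (xs ys : List A) (f : A → Poly) → ΣP (xs ++ ys) f ≋ (ΣP xs f +P ΣP ys f)
ΣP-++ []       ys f = ≋-refl
ΣP-++ (x ∷ xs) ys f = ≋-trans (+P-congʳ (f x) (ΣP-++ xs ys f)) (≋-sym (+P-assoc (f x) (ΣP xs f) (ΣP ys f)))

ΣP-map : ∀ {A B : Set} (g : A → B) (xs : List A) (f : B → Poly) → ΣP (map g xs) f ≡ ΣP xs (λ x → f (g x))
ΣP-map g []       f = refl
ΣP-map g (x ∷ xs) f = cong (f (g x) +P_) (ΣP-map g xs f)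

ΣP-concatMap : ∀ {A B : Set} (g : A → List B) (xs : List A) (f : B → Poly) →
  ΣP (concatMap g xs) f ≋ ΣP xs (λ x → ΣP (g x) f)
ΣP-concatMap g []       f = ≋-refl
ΣP-concatMap g (x ∷ xs) f = ≋-trans (ΣP-++ (g x) (concatMap g xs) f) (+P-congʳ (ΣP (g x) f) (ΣP-concatMap g xs f))

*P-distribˡ-ΣP : ∀ {A : Set} p (xs : List A) (f : A → Poly) → (p *P ΣP xs f) ≋ ΣP xs (λ x → p *P f x)
*P-distribˡ-ΣP p []       f = *P-zeroʳ p
*P-distribˡ-ΣP p (x ∷ xs) f = ≋-trans (*P-distribˡ p (f x) (ΣP xs f)) (+P-congʳ (p *P f x) (*P-distribˡ-ΣP p xs f))

*P-distribʳ-ΣP : ∀ {A : Set} p (xs : List A) (f : A → Poly) → (ΣP xs f *P p) ≋ ΣP xs (λ x → f x *P p)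
*P-distribʳ-ΣP p xs f =
  ≋-trans (*P-comm (ΣP xs f) p) (≋-trans (*P-distribˡ-ΣP p xs f) (ΣP-cong xs λ x _ → *P-comm p (f x)))

-P-ΣP : ∀ {A : Set} (xs : List A) (f : A → Poly) → ΣP xs (λ x → -P f x) ≋ (-P ΣP xs f)
-P-ΣP []       f = ≋-refl
-P-ΣP (x ∷ xs) f = ≋-trans (+P-congʳ (-P f x) (-P-ΣP xs f)) (-P-+P (f x) (ΣP xs f))
  where
  -P-+P : ∀ p q → ((-P p) +P (-P q)) ≋ (-P (p +P q))
  -P-+P = solve-∀ ℤ[u]-solver

ΣP-↭ : ∀ {A : Set} {xs ys : List A} (f : A → Poly) → xs ↭ ys → ΣP xs f ≋ ΣP ys f
ΣP-↭ f ↭.refl         = ≋-refl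
ΣP-↭ f (↭.prep x p)   = +P-congʳ (f x) (ΣP-↭ f p)
ΣP-↭ f (↭.swap {xs} {ys} x y p) = begin
  f x +P (f y +P ΣP xs f) ≈⟨ +P-assoc (f x) (f y) (ΣP xs f) ⟨
  (f x +P f y) +P ΣP xs f ≈⟨ +P-cong (+P-comm (f x) (f y)) (ΣP-↭ f p) ⟩
  (f y +P f x) +P ΣP ys f ≈⟨ +P-assoc (f y) (f x) (ΣP ys f) ⟩
  f y +P (f x +P ΣP ys f) ∎
  where open ≋-Reasoning
ΣP-↭ f (↭.trans p q)  = ≋-trans (ΣP-↭ f p) (ΣP-↭ f q)

monomial-+ : ∀ a b → monomial (a ℕ.+ b) ≋ (monomial a *P monomial b)
monomial-+ zero    b = ≋-sym (*P-identityˡ (monomial b))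
monomial-+ (suc a) b = ≋-trans (∷-cong refl (monomial-+ a b)) (≋-sym (0∷-*P (monomial a) (monomial b)))

^P-+ : ∀ p a b → (p ^P (a ℕ.+ b)) ≋ ((p ^P a) *P (p ^P b))
^P-+ p zero    b = ≋-sym (*P-identityˡ _)
^P-+ p (suc a) b = ≋-trans (*P-congʳ p (^P-+ p a b)) (≋-sym (*P-assoc p (p ^P a) (p ^P b)))

coeff₀-*P : ∀ p q → coeff (p *P q) 0 ≡ coeff p 0 ℤ.* coeff q 0
coeff₀-*P []      q = refl
coeff₀-*P (a ∷ p) q = trans (coeff-+P (scale a q) (0ℤ ∷ (p *P q)) 0) (trans (ℤ.+-identityʳ _) (coeff-scale a q 0))

-- The coefficients of g vanish one at a time, from the bottom up.
*P-cancelˡ-[] : ∀ f g → coeff f 0 ≡ 1ℤ → (f *P g) ≋ [] → g ≋ []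
*P-cancelˡ-[] f g f₀≡1 fg≋[] = mk≋ λ i → go i g fg≋[]
  where
  go : ∀ i g → (f *P g) ≋ [] → coeff g i ≡ 0ℤ
  go i       []      _      = refl
  go zero    (b ∷ g) fg≋[] = begin
    b                          ≡⟨ ℤ.*-identityˡ b ⟨
    1ℤ ℤ.* b                   ≡⟨ cong (ℤ._* b) f₀≡1 ⟨
    coeff f 0 ℤ.* b            ≡⟨ coeff₀-*P f (b ∷ g) ⟨
    coeff (f *P (b ∷ g)) 0     ≡⟨ coeff-≡ fg≋[] 0 ⟩
    0ℤ                         ∎
    where open ≡-Reasoning
  go (suc i) (b ∷ g) fg≋[] = go i g (∷-injectiveʳ (begin
    0ℤ ∷ (f *P g)         ≈⟨ ∷-cong refl (*P-comm f g) ⟩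
    0ℤ ∷ (g *P f)         ≈⟨ 0∷-*P g f ⟨
    (0ℤ ∷ g) *P f         ≈⟨ *P-comm (0ℤ ∷ g) f ⟩
    f *P (0ℤ ∷ g)         ≈⟨ *P-congʳ f (∷-cong (sym (go zero (b ∷ g) fg≋[])) ≋-refl) ⟩
    f *P (b ∷ g)          ≈⟨ fg≋[] ⟩
    []                    ≈⟨ 0∷-[] ≋-refl ⟨
    0ℤ ∷ []               ∎))
    where open ≋-Reasoning

*P-cancelˡ : ∀ f g g′ → coeff f 0 ≡ 1ℤ → (f *P g) ≋ (f *P g′) → g ≋ g′
*P-cancelˡ f g g′ f₀≡1 fg≋fg′ = begin
  g                       ≈⟨ sub-add g g′ ⟩
  (g +P (-P g′)) +P g′    ≈⟨ +P-congˡ g′ (*P-cancelˡ-[] f _ f₀≡1 f[g-g′]≋[]) ⟩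
  g′                      ∎
  where
  open ≋-Reasoning
  sub-add : ∀ g g′ → g ≋ ((g +P (-P g′)) +P g′)
  sub-add g g′ = ≋-sym (≋-trans (+P-assoc g (-P g′) g′) (≋-trans (+P-congʳ g (-P-inverseˡ g′)) (+P-identityʳ g)))
  distrib : ∀ f g g′ → (f *P (g +P (-P g′))) ≋ ((f *P g) +P (-P (f *P g′)))
  distrib = solve-∀ ℤ[u]-solver
  f[g-g′]≋[] : (f *P (g +P (-P g′))) ≋ []
  f[g-g′]≋[] = ≋-trans (distrib f g g′) (≋-trans (+P-congˡ (-P (f *P g′)) fg≋fg′) (-P-inverseʳ (f *P g′)))

∑-const-0 : ∀ n → ∑[ i < n ] 0 ≡ 0
∑-const-0 zero    = refl
∑-const-0 (suc n) = ∑-const-0 n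

∑-const-1 : ∀ n → ∑[ i < n ] 1 ≡ n
∑-const-1 zero    = refl
∑-const-1 (suc n) = cong suc (∑-const-1 n)

sum-map-allFin : ∀ n (f : Fin n → ℕ) → ListAction.sum (map f (allFin n)) ≡ ∑[ i < n ] f i
sum-map-allFin n f = trans (cong ListAction.sum (List.map-tabulate (λ i → i) f)) (sum-tabulate n f)
  where
  sum-tabulate : ∀ n (f : Fin n → ℕ) → ListAction.sum (List.tabulate f) ≡ sum f
  sum-tabulate zero    f = refl
  sum-tabulate (suc n) f = cong (f Fin.zero ℕ.+_) (sum-tabulate n (λ i → f (Fin.suc i)))

adj : ∀ {n} → Digraph n → Fin n → Fin n → Bool
adj D s t = lookup (lookup D s) t

descentAt : ∀ {n} → Digraph n → Fin n → Fin n → ℕ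
descentAt D s t = if adj D s t ∧ (toℕ t ℕ.<ᵇ toℕ s) then 1 else 0

des-∑ : ∀ {n} (D : Digraph n) → des D ≡ ∑[ s < n ] ∑[ t < n ] descentAt D s t
des-∑ {n} D = begin
  ListAction.sum (concatMap (λ s → map (descentAt D s) (allFin n)) (allFin n))
    ≡⟨ sum-concatMap _ (allFin n) ⟩
  ListAction.sum (map (λ s → ListAction.sum (map (descentAt D s) (allFin n))) (allFin n))
    ≡⟨ cong ListAction.sum (List.map-cong (λ s → sum-map-allFin n (descentAt D s)) (allFin n)) ⟩
  ListAction.sum (map (λ s → ∑[ t < n ] descentAt D s t) (allFin n))
    ≡⟨ sum-map-allFin n _ ⟩
  ∑[ s < n ] ∑[ t < n ] descentAt D s t
    ∎
  where
  open ≡-Reasoning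
  sum-concatMap : ∀ {A : Set} (g : A → List ℕ) xs →
    ListAction.sum (concatMap g xs) ≡ ListAction.sum (map (λ x → ListAction.sum (g x)) xs)
  sum-concatMap g []       = refl
  sum-concatMap g (x ∷ xs) =
    trans (ListAction.sum-++ (g x) (concatMap g xs)) (cong (ListAction.sum (g x) ℕ.+_) (sum-concatMap g xs))

∈-concatMap⁺ : ∀ {A B : Set} (f : A → List B) {xs : List A} {x : A} {z : B} → x ∈ xs → z ∈ f x → z ∈ concatMap f xs
∈-concatMap⁺ f x∈xs z∈fx = ∈-concat⁺′ z∈fx (∈-map⁺ f x∈xs)

∈-concatMap⁻ : ∀ {A B : Set} (f : A → List B) (xs : List A) {z : B} → z ∈ concatMap f xs → Σ[ x ∈ A ] x ∈ xs × z ∈ f x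
∈-concatMap⁻ f xs z∈ with ∈-concat⁻′ (map f xs) z∈
... | ys , z∈ys , ys∈ with ∈-map⁻ f ys∈
...   | x , x∈xs , refl = x , x∈xs , z∈ys

concatMap-Unique : ∀ {A B : Set} (f : A → List B) (xs : List A) → Unique xs → (∀ x → x ∈ xs → Unique (f x)) →
  (∀ x y z → x ∈ xs → y ∈ xs → z ∈ f x → z ∈ f y → x ≡ y) → Unique (concatMap f xs)
concatMap-Unique f []       _              _        _        = AllPairs.[]
concatMap-Unique f (x ∷ xs) (x∉xs AllPairs.∷ xs!) f-unique disjoint =
  ++⁺ (f-unique x (here refl))
      (concatMap-Unique f xs xs! (λ y y∈ → f-unique y (there y∈)) (λ a b z a∈ b∈ → disjoint a b z (there a∈) (there b∈)))
      apart
  where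
  apart : ∀ {z} → z ∈ f x × z ∈ concatMap f xs → ⊥
  apart (z∈fx , z∈rest) with ∈-concatMap⁻ f xs z∈rest
  ... | y , y∈xs , z∈fy with disjoint x y _ (here refl) (there y∈xs) z∈fx z∈fy
  ...   | refl = All.lookup x∉xs y∈xs refl

-- Digraphs and tournaments

fromAdj : ∀ {n} → (Fin n → Fin n → Bool) → Digraph n
fromAdj f = tabulate (λ i → tabulate (f i))

adj-fromAdj : ∀ {n} (f : Fin n → Fin n → Bool) i j → adj (fromAdj f) i j ≡ f i j
adj-fromAdj f i j =
  trans (cong (λ row → lookup row j) (Vec.lookup∘tabulate (λ i → tabulate (f i)) i)) (Vec.lookup∘tabulate (f i) j)

vec-ext : ∀ {A : Set} {n} {v w : Vec A n} → (∀ i → lookup v i ≡ lookup w i) → v ≡ w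
vec-ext {v = v} {w} v≗w = trans (sym (Vec.tabulate∘lookup v)) (trans (Vec.tabulate-cong v≗w) (Vec.tabulate∘lookup w))

adj-ext : ∀ {n} {D D′ : Digraph n} → (∀ i j → adj D i j ≡ adj D′ i j) → D ≡ D′
adj-ext D≗D′ = vec-ext λ i → vec-ext (D≗D′ i)

restrict : ∀ {k n} → (Fin k → Fin n) → Digraph n → Digraph k
restrict e D = fromAdj λ a b → adj D (e a) (e b)

adj-restrict : ∀ {k n} (e : Fin k → Fin n) (D : Digraph n) a b → adj (restrict e D) a b ≡ adj D (e a) (e b)
adj-restrict e D = adj-fromAdj λ a b → adj D (e a) (e b)

_++ᵖ_ : ∀ {n} {D : Digraph n} {a b c} → Path D a b → Path D b c → Path D a c
here     ++ᵖ q = q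
step e p ++ᵖ q = step e (p ++ᵖ q)

Path-map : ∀ {n k} {D : Digraph n} {D′ : Digraph k} (f : Fin n → Fin k) →
  (∀ {a b} → Edge D a b → Edge D′ (f a) (f b)) → ∀ {a b} → Path D a b → Path D′ (f a) (f b)
Path-map f f-edge here       = here
Path-map f f-edge (step e p) = step (f-edge e) (Path-map f f-edge p)

Tournament-adj : ∀ {n} → Digraph n → Set
Tournament-adj D = (∀ s → adj D s s ≡ false) × (∀ s t → s ≢ t → adj D t s ≡ not (adj D s t))

IsTournament⇒Tournament-adj : ∀ {n} (D : Digraph n) → IsTournament D → Tournament-adj D
IsTournament⇒Tournament-adj D (irrefl , total , antisym) =
  (λ s → Bool.¬-not (irrefl s)) , flip
  where
  flip : ∀ s t → s ≢ t → adj D t s ≡ not (adj D s t)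
  flip s t s≢t with total s t s≢t
  ... | inj₁ s→t = trans (Bool.¬-not (antisym s t s→t)) (cong not (sym s→t))
  ... | inj₂ t→s = trans t→s (cong not (sym (Bool.¬-not (antisym t s t→s))))

Tournament-adj⇒IsTournament : ∀ {n} (D : Digraph n) → Tournament-adj D → IsTournament D
Tournament-adj⇒IsTournament D (irrefl , flip) = noLoop , total , antisym
  where
  noLoop : ∀ s → ¬ Edge D s s
  noLoop s s→s with trans (sym s→s) (irrefl s)
  ... | ()
  total : ∀ s t → s ≢ t → Edge D s t ⊎ Edge D t s
  total s t s≢t with adj D s t in s→t
  ... | true  = inj₁ refl
  ... | false = inj₂ (trans (flip s t s≢t) (cong not s→t))
  antisym : ∀ s t → Edge D s t → ¬ Edge D t s
  antisym s t s→t t→s with s Fin.≟ t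
  ... | yes refl = noLoop s s→t
  ... | no s≢t with trans (sym t→s) (trans (flip s t s≢t) (cong not s→t))
  ...   | ()

tournament-edge : ∀ {n} (D : Digraph n) → IsTournament D → ∀ {s t} → s ≢ t → ¬ Edge D t s → Edge D s t
tournament-edge D (_ , total , _) {s} {t} s≢t ¬t→s with total s t s≢t
... | inj₁ s→t = s→t
... | inj₂ t→s = ⊥-elim (¬t→s t→s)

restrict-IsTournament : ∀ {k n} (e : Fin k → Fin n) → Injective _≡_ _≡_ e →
  (D : Digraph n) → IsTournament D → IsTournament (restrict e D)
restrict-IsTournament e e-inj D T = Tournament-adj⇒IsTournament (restrict e D)
  ( (λ s → trans (adj-restrict e D s s) (irrefl (e s)))
  , λ s t s≢t → trans (adj-restrict e D t s)
      (trans (flip (e s) (e t) (λ es≡et → s≢t (e-inj es≡et))) (cong not (sym (adj-restrict e D s t)))))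
  where
  irrefl = proj₁ (IsTournament⇒Tournament-adj D T)
  flip = proj₂ (IsTournament⇒Tournament-adj D T)

-- Splitting the vertices and merging tournaments

variable
  n k m : ℕ

-- Split n k m: the vertices 0, …, n-1 divided into a left part of size k and a right part of
-- size m, each numbered in increasing order; the constructor says where the least vertex goes.
data Split : ℕ → ℕ → ℕ → Set where
  nil   : Split 0 0 0
  left  : Split n k m → Split (suc n) (suc k) m
  right : Split n k m → Split (suc n) k (suc m)

embedˡ : Split n k m → Fin k → Fin n
embedˡ (left S)  Fin.zero    = Fin.zero
embedˡ (left S)  (Fin.suc a) = Fin.suc (embedˡ S a)
embedˡ (right S) a           = Fin.suc (embedˡ S a)

embedʳ : Split n k m → Fin m → Fin n
embedʳ (left S)  b           = Fin.suc (embedʳ S b)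
embedʳ (right S) Fin.zero    = Fin.zero
embedʳ (right S) (Fin.suc b) = Fin.suc (embedʳ S b)

part : Split n k m → Fin n → Fin k ⊎ Fin m
part (left S)  Fin.zero    = inj₁ Fin.zero
part (left S)  (Fin.suc i) = Sum.map₁ Fin.suc (part S i)
part (right S) Fin.zero    = inj₂ Fin.zero
part (right S) (Fin.suc i) = Sum.map₂ Fin.suc (part S i)

part-embedˡ : (S : Split n k m) → ∀ a → part S (embedˡ S a) ≡ inj₁ a
part-embedˡ (left S)  Fin.zero    = refl
part-embedˡ (left S)  (Fin.suc a) = cong (Sum.map₁ Fin.suc) (part-embedˡ S a)
part-embedˡ (right S) a           = cong (Sum.map₂ Fin.suc) (part-embedˡ S a)

part-embedʳ : (S : Split n k m) → ∀ b → part S (embedʳ S b) ≡ inj₂ b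
part-embedʳ (left S)  b           = cong (Sum.map₁ Fin.suc) (part-embedʳ S b)
part-embedʳ (right S) Fin.zero    = refl
part-embedʳ (right S) (Fin.suc b) = cong (Sum.map₂ Fin.suc) (part-embedʳ S b)

embedˡ-part : (S : Split n k m) → ∀ {i a} → part S i ≡ inj₁ a → embedˡ S a ≡ i
embedˡ-part (left S)  {Fin.zero}  refl = refl
embedˡ-part (left S)  {Fin.suc i} eq with part S i in eq′
embedˡ-part (left S)  {Fin.suc i} refl | inj₁ a = cong Fin.suc (embedˡ-part S eq′)
embedˡ-part (right S) {Fin.suc i} eq with part S i in eq′
embedˡ-part (right S) {Fin.suc i} refl | inj₁ a = cong Fin.suc (embedˡ-part S eq′)

embedʳ-part : (S : Split n k m) → ∀ {i b} → part S i ≡ inj₂ b → embedʳ S b ≡ i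
embedʳ-part (left S)  {Fin.suc i} eq with part S i in eq′
embedʳ-part (left S)  {Fin.suc i} refl | inj₂ b = cong Fin.suc (embedʳ-part S eq′)
embedʳ-part (right S) {Fin.zero}  refl = refl
embedʳ-part (right S) {Fin.suc i} eq with part S i in eq′
embedʳ-part (right S) {Fin.suc i} refl | inj₂ b = cong Fin.suc (embedʳ-part S eq′)

embedˡ-injective : (S : Split n k m) → Injective _≡_ _≡_ (embedˡ S)
embedˡ-injective S {a} {b} eq = Sum.inj₁-injective
  (trans (sym (part-embedˡ S a)) (trans (cong (part S) eq) (part-embedˡ S b)))

embedʳ-injective : (S : Split n k m) → Injective _≡_ _≡_ (embedʳ S)
embedʳ-injective S {a} {b} eq = Sum.inj₂-injective
  (trans (sym (part-embedʳ S a)) (trans (cong (part S) eq) (part-embedʳ S b)))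

embedˡ-<ᵇ : (S : Split n k m) → ∀ a b → (toℕ (embedˡ S a) ℕ.<ᵇ toℕ (embedˡ S b)) ≡ (toℕ a ℕ.<ᵇ toℕ b)
embedˡ-<ᵇ (left S)  Fin.zero    Fin.zero    = refl
embedˡ-<ᵇ (left S)  Fin.zero    (Fin.suc b) = refl
embedˡ-<ᵇ (left S)  (Fin.suc a) Fin.zero    = refl
embedˡ-<ᵇ (left S)  (Fin.suc a) (Fin.suc b) = embedˡ-<ᵇ S a b
embedˡ-<ᵇ (right S) a           b           = embedˡ-<ᵇ S a b

embedʳ-<ᵇ : (S : Split n k m) → ∀ a b → (toℕ (embedʳ S a) ℕ.<ᵇ toℕ (embedʳ S b)) ≡ (toℕ a ℕ.<ᵇ toℕ b)
embedʳ-<ᵇ (left S)  a           b           = embedʳ-<ᵇ S a b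
embedʳ-<ᵇ (right S) Fin.zero    Fin.zero    = refl
embedʳ-<ᵇ (right S) Fin.zero    (Fin.suc b) = refl
embedʳ-<ᵇ (right S) (Fin.suc a) Fin.zero    = refl
embedʳ-<ᵇ (right S) (Fin.suc a) (Fin.suc b) = embedʳ-<ᵇ S a b

∑-split : (S : Split n k m) (g : Fin n → ℕ) →
  ∑[ i < n ] g i ≡ ∑[ a < k ] g (embedˡ S a) ℕ.+ ∑[ b < m ] g (embedʳ S b)
∑-split nil       g = refl
∑-split (left S)  g = trans (cong (g Fin.zero ℕ.+_) (∑-split S (g ∘ Fin.suc))) (sym (ℕ.+-assoc (g Fin.zero) _ _))
∑-split (right {k = k} S) g = trans (cong (g Fin.zero ℕ.+_) (∑-split S (g ∘ Fin.suc)))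
  (x∙yz≈y∙xz (g Fin.zero) (∑[ a < k ] g (Fin.suc (embedˡ S a))) _)

inverted : Split n k m → Fin k → Fin m → ℕ
inverted S a b = if toℕ (embedʳ S b) ℕ.<ᵇ toℕ (embedˡ S a) then 1 else 0

inversions : Split n k m → ℕ
inversions {k = k} {m} S = ∑[ a < k ] ∑[ b < m ] inverted S a b

inversions-left : (S : Split n k m) → inversions (left S) ≡ inversions S
inversions-left {m = m} S = cong (ℕ._+ inversions S) (∑-const-0 m)

inversions-right : (S : Split n k m) → inversions (right S) ≡ k ℕ.+ inversions S
inversions-right {k = k} {m} S = trans (∑-distrib-+ (λ _ → 1) (λ a → ∑[ b < m ] inverted S a b)) (cong (ℕ._+ inversions S) (∑-const-1 k))

∑²-split : (S : Split n k m) (h : Fin n → Fin n → ℕ) →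
  ∑[ s < n ] ∑[ t < n ] h s t ≡
    (∑[ a < k ] ∑[ a′ < k ] h (embedˡ S a) (embedˡ S a′) ℕ.+ ∑[ a < k ] ∑[ b′ < m ] h (embedˡ S a) (embedʳ S b′))
    ℕ.+ (∑[ b < m ] ∑[ a′ < k ] h (embedʳ S b) (embedˡ S a′) ℕ.+ ∑[ b < m ] ∑[ b′ < m ] h (embedʳ S b) (embedʳ S b′))
∑²-split {n} {k} {m} S h = begin
  ∑[ s < n ] ∑[ t < n ] h s t
    ≡⟨ ∑-split S (λ s → ∑[ t < n ] h s t) ⟩
  ∑[ a < k ] ∑[ t < n ] h (embedˡ S a) t ℕ.+ ∑[ b < m ] ∑[ t < n ] h (embedʳ S b) t
    ≡⟨ cong₂ ℕ._+_ (sum-cong-≗ (λ a → ∑-split S (h (embedˡ S a)))) (sum-cong-≗ (λ b → ∑-split S (h (embedʳ S b)))) ⟩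
  ∑[ a < k ] (∑[ a′ < k ] h (embedˡ S a) (embedˡ S a′) ℕ.+ ∑[ b′ < m ] h (embedˡ S a) (embedʳ S b′))
    ℕ.+ ∑[ b < m ] (∑[ a′ < k ] h (embedʳ S b) (embedˡ S a′) ℕ.+ ∑[ b′ < m ] h (embedʳ S b) (embedʳ S b′))
    ≡⟨ cong₂ ℕ._+_ (∑-distrib-+ (λ a → ∑[ a′ < k ] h (embedˡ S a) (embedˡ S a′)) _)
                   (∑-distrib-+ (λ b → ∑[ a′ < k ] h (embedʳ S b) (embedˡ S a′)) _) ⟩
  _ ∎
  where open ≡-Reasoning

mergeAdj : Digraph k → Digraph m → Fin k ⊎ Fin m → Fin k ⊎ Fin m → Bool
mergeAdj D₁ D₂ (inj₁ a) (inj₁ b) = adj D₁ a b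
mergeAdj D₁ D₂ (inj₁ a) (inj₂ b) = true
mergeAdj D₁ D₂ (inj₂ a) (inj₁ b) = false
mergeAdj D₁ D₂ (inj₂ a) (inj₂ b) = adj D₂ a b

merge : Split n k m → Digraph k → Digraph m → Digraph n
merge S D₁ D₂ = fromAdj λ i j → mergeAdj D₁ D₂ (part S i) (part S j)

module _ (S : Split n k m) (D₁ : Digraph k) (D₂ : Digraph m) where

  adj-merge : ∀ {i j x y} → part S i ≡ x → part S j ≡ y → adj (merge S D₁ D₂) i j ≡ mergeAdj D₁ D₂ x y
  adj-merge {i} {j} refl refl = adj-fromAdj (λ i j → mergeAdj D₁ D₂ (part S i) (part S j)) i j

  adj-merge-ˡˡ : ∀ a b → adj (merge S D₁ D₂) (embedˡ S a) (embedˡ S b) ≡ adj D₁ a b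
  adj-merge-ˡˡ a b = adj-merge (part-embedˡ S a) (part-embedˡ S b)

  adj-merge-ʳʳ : ∀ a b → adj (merge S D₁ D₂) (embedʳ S a) (embedʳ S b) ≡ adj D₂ a b
  adj-merge-ʳʳ a b = adj-merge (part-embedʳ S a) (part-embedʳ S b)

  adj-merge-ˡʳ : ∀ a b → adj (merge S D₁ D₂) (embedˡ S a) (embedʳ S b) ≡ true
  adj-merge-ˡʳ a b = adj-merge (part-embedˡ S a) (part-embedʳ S b)

  adj-merge-ʳˡ : ∀ a b → adj (merge S D₁ D₂) (embedʳ S a) (embedˡ S b) ≡ false
  adj-merge-ʳˡ a b = adj-merge (part-embedʳ S a) (part-embedˡ S b)

  des-merge : des (merge S D₁ D₂) ≡ (des D₁ ℕ.+ des D₂) ℕ.+ inversions S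
  des-merge = begin
    des M
      ≡⟨ trans (des-∑ M) (∑²-split S (descentAt M)) ⟩
    (∑[ a < k ] ∑[ a′ < k ] descentAt M (embedˡ S a) (embedˡ S a′) ℕ.+ ∑[ a < k ] ∑[ b′ < m ] descentAt M (embedˡ S a) (embedʳ S b′))
    ℕ.+ (∑[ b < m ] ∑[ a′ < k ] descentAt M (embedʳ S b) (embedˡ S a′) ℕ.+ ∑[ b < m ] ∑[ b′ < m ] descentAt M (embedʳ S b) (embedʳ S b′))
      ≡⟨ cong₂ ℕ._+_ (cong₂ ℕ._+_ (trans (sum-cong-≗ λ a → sum-cong-≗ (ˡˡ a)) (sym (des-∑ D₁)))
                                    (sum-cong-≗ λ a → sum-cong-≗ (ˡʳ a)))
                      (cong₂ ℕ._+_ (trans (sum-cong-≗ λ b → trans (sum-cong-≗ (ʳˡ b)) (∑-const-0 k)) (∑-const-0 m))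
                                    (trans (sum-cong-≗ λ b → sum-cong-≗ (ʳʳ b)) (sym (des-∑ D₂)))) ⟩
    (des D₁ ℕ.+ inversions S) ℕ.+ (0 ℕ.+ des D₂)
      ≡⟨ ℕ.+-assoc (des D₁) (inversions S) (des D₂) ⟩
    des D₁ ℕ.+ (inversions S ℕ.+ des D₂)
      ≡⟨ cong (des D₁ ℕ.+_) (ℕ.+-comm (inversions S) (des D₂)) ⟩
    des D₁ ℕ.+ (des D₂ ℕ.+ inversions S)
      ≡⟨ ℕ.+-assoc (des D₁) (des D₂) (inversions S) ⟨
    (des D₁ ℕ.+ des D₂) ℕ.+ inversions S
      ∎
    where
    open ≡-Reasoning
    M = merge S D₁ D₂
    ˡˡ : ∀ a a′ → descentAt M (embedˡ S a) (embedˡ S a′) ≡ descentAt D₁ a a′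
    ˡˡ a a′ rewrite adj-merge-ˡˡ a a′ | embedˡ-<ᵇ S a′ a = refl
    ˡʳ : ∀ a b′ → descentAt M (embedˡ S a) (embedʳ S b′) ≡ inverted S a b′
    ˡʳ a b′ rewrite adj-merge-ˡʳ a b′ = refl
    ʳˡ : ∀ b a′ → descentAt M (embedʳ S b) (embedˡ S a′) ≡ 0
    ʳˡ b a′ rewrite adj-merge-ʳˡ b a′ = refl
    ʳʳ : ∀ b b′ → descentAt M (embedʳ S b) (embedʳ S b′) ≡ descentAt D₂ b b′
    ʳʳ b b′ rewrite adj-merge-ʳʳ b b′ | embedʳ-<ᵇ S b′ b = refl

part-injective : (S : Split n k m) → Injective _≡_ _≡_ (part S)
part-injective S {i} {j} eq with part S i in pi | part S j in pj
part-injective S {i} {j} refl | inj₁ a | inj₁ .a = trans (sym (embedˡ-part S pi)) (embedˡ-part S pj)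
part-injective S {i} {j} refl | inj₂ b | inj₂ .b = trans (sym (embedʳ-part S pi)) (embedʳ-part S pj)

part-≢ : (S : Split n k m) → ∀ {i j a b} → part S i ≡ inj₁ a → part S j ≡ inj₂ b → i ≢ j
part-≢ S pᵢ pⱼ refl with trans (sym pᵢ) pⱼ
... | ()

mergeAdj-Tournament : {D₁ : Digraph k} {D₂ : Digraph m} → Tournament-adj D₁ → Tournament-adj D₂ →
  ∀ x y → x ≢ y → mergeAdj D₁ D₂ y x ≡ not (mergeAdj D₁ D₂ x y)
mergeAdj-Tournament T₁ T₂ (inj₁ a) (inj₁ b) x≢y = proj₂ T₁ a b (λ a≡b → x≢y (cong inj₁ a≡b))
mergeAdj-Tournament T₁ T₂ (inj₁ a) (inj₂ b) x≢y = refl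
mergeAdj-Tournament T₁ T₂ (inj₂ a) (inj₁ b) x≢y = refl
mergeAdj-Tournament T₁ T₂ (inj₂ a) (inj₂ b) x≢y = proj₂ T₂ a b (λ a≡b → x≢y (cong inj₂ a≡b))

module _ (S : Split n k m) (D₁ : Digraph k) (D₂ : Digraph m) where

  merge-IsTournament : IsTournament D₁ → IsTournament D₂ → IsTournament (merge S D₁ D₂)
  merge-IsTournament T₁ T₂ = Tournament-adj⇒IsTournament (merge S D₁ D₂) (irrefl , flip)
    where
    A₁ = IsTournament⇒Tournament-adj D₁ T₁
    A₂ = IsTournament⇒Tournament-adj D₂ T₂
    irrefl : ∀ s → adj (merge S D₁ D₂) s s ≡ false
    irrefl s with part S s in ps
    ... | inj₁ a = trans (adj-merge S D₁ D₂ ps ps) (proj₁ A₁ a)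
    ... | inj₂ b = trans (adj-merge S D₁ D₂ ps ps) (proj₁ A₂ b)
    flip : ∀ s t → s ≢ t → adj (merge S D₁ D₂) t s ≡ not (adj (merge S D₁ D₂) s t)
    flip s t s≢t = trans (adj-merge S D₁ D₂ refl refl)
      (trans (mergeAdj-Tournament A₁ A₂ (part S s) (part S t) (λ eq → s≢t (part-injective S eq)))
             (cong not (sym (adj-merge S D₁ D₂ refl refl))))

  restrict-merge-embedˡ : restrict (embedˡ S) (merge S D₁ D₂) ≡ D₁
  restrict-merge-embedˡ = adj-ext λ a b → trans (adj-restrict (embedˡ S) (merge S D₁ D₂) a b) (adj-merge-ˡˡ S D₁ D₂ a b)

  restrict-merge-embedʳ : restrict (embedʳ S) (merge S D₁ D₂) ≡ D₂
  restrict-merge-embedʳ = adj-ext λ a b → trans (adj-restrict (embedʳ S) (merge S D₁ D₂) a b) (adj-merge-ʳʳ S D₁ D₂ a b)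

  Path-merge-from-right : ∀ {i j b} → Path (merge S D₁ D₂) i j → part S i ≡ inj₂ b → Σ[ b′ ∈ Fin m ] part S j ≡ inj₂ b′
  Path-merge-from-right here pᵢ = _ , pᵢ
  Path-merge-from-right (step {b = c} e p) pᵢ with part S c in p꜀
  ... | inj₂ b′ = Path-merge-from-right p p꜀
  ... | inj₁ a′ with trans (sym e) (adj-merge S D₁ D₂ pᵢ p꜀)
  ...   | ()

  Path-merge-embedˡ : ∀ {a b} → Path D₁ a b → Path (merge S D₁ D₂) (embedˡ S a) (embedˡ S b)
  Path-merge-embedˡ = Path-map (embedˡ S) λ {a} {b} e → trans (adj-merge-ˡˡ S D₁ D₂ a b) e

  Path-merge-within-left : ∀ {i j a b} → Path (merge S D₁ D₂) i j → part S i ≡ inj₁ a → part S j ≡ inj₁ b → Path D₁ a b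
  Path-merge-within-left here pᵢ pⱼ with trans (sym pᵢ) pⱼ
  ... | refl = here
  Path-merge-within-left (step {b = c} e p) pᵢ pⱼ with part S c in p꜀
  ... | inj₁ a′ = step (trans (sym (adj-merge S D₁ D₂ pᵢ p꜀)) e) (Path-merge-within-left p p꜀ pⱼ)
  ... | inj₂ b′ with Path-merge-from-right p p꜀
  ...   | _ , pⱼ′ with trans (sym pⱼ) pⱼ′
  ...     | ()

isInj₁ : ∀ {A B : Set} → A ⊎ B → Bool
isInj₁ (inj₁ _) = true
isInj₁ (inj₂ _) = false

isInj₁-map₁ : ∀ {A A′ B : Set} (f : A → A′) (x : A ⊎ B) → isInj₁ (Sum.map₁ f x) ≡ isInj₁ x
isInj₁-map₁ f (inj₁ _) = refl
isInj₁-map₁ f (inj₂ _) = refl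

isInj₁-map₂ : ∀ {A B B′ : Set} (f : B → B′) (x : A ⊎ B) → isInj₁ (Sum.map₂ f x) ≡ isInj₁ x
isInj₁-map₂ f (inj₁ _) = refl
isInj₁-map₂ f (inj₂ _) = refl

AnySplit : ℕ → Set
AnySplit n = Σ[ k ∈ ℕ ] Σ[ m ∈ ℕ ] Split n k m

split-ext : ∀ {k′ m′} (S : Split n k m) (S′ : Split n k′ m′) →
  (∀ i → isInj₁ (part S i) ≡ isInj₁ (part S′ i)) → _≡_ {A = AnySplit n} (k , m , S) (k′ , m′ , S′)
split-ext nil       nil        same = refl
split-ext (left S)  (left S′)  same
  with split-ext S S′ (λ i → trans (sym (isInj₁-map₁ Fin.suc (part S i))) (trans (same (Fin.suc i)) (isInj₁-map₁ Fin.suc (part S′ i))))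
... | refl = refl
split-ext (right S) (right S′) same
  with split-ext S S′ (λ i → trans (sym (isInj₁-map₂ Fin.suc (part S i))) (trans (same (Fin.suc i)) (isInj₁-map₂ Fin.suc (part S′ i))))
... | refl = refl
split-ext (left S)  (right S′) same with same Fin.zero
... | ()
split-ext (right S) (left S′)  same with same Fin.zero
... | ()

module _ {k′ m′} (S : Split n k m) (S′ : Split n (suc k′) m′)
         {D₁ D₂ D₁′ D₂′} (D₁-strong : StronglyConnected D₁) (M≡M′ : merge S D₁ D₂ ≡ merge S′ D₁′ D₂′) where

  -- A vertex in the left part of S reaches everything in that part, hence the least vertex of the
  -- left part of S′; in merge S′ nothing on the right reaches the left.
  left⇒¬right : ∀ {i a b′} → part S i ≡ inj₁ a → part S′ i ≡ inj₂ b′ → ⊥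
  left⇒¬right {i} pᵢ p′ᵢ with part S (embedˡ S′ Fin.zero) in pⱼ
  ... | inj₁ b with Path-merge-from-right S′ D₁′ D₂′
                      (subst (λ M → Path M i (embedˡ S′ Fin.zero)) M≡M′
                        (subst₂ (Path (merge S D₁ D₂)) (embedˡ-part S pᵢ) (embedˡ-part S pⱼ)
                          (Path-merge-embedˡ S D₁ D₂ (D₁-strong _ b))))
                      p′ᵢ
  ...   | _ , p′ⱼ with trans (sym (part-embedˡ S′ Fin.zero)) p′ⱼ
  ...     | ()
  left⇒¬right {i} pᵢ p′ᵢ | inj₂ b
    with trans (sym (adj-merge S D₁ D₂ pᵢ pⱼ))
           (trans (cong (λ M → adj M i (embedˡ S′ Fin.zero)) M≡M′) (adj-merge S′ D₁′ D₂′ p′ᵢ (part-embedˡ S′ Fin.zero)))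
  ... | ()

top-part-unique : ∀ {k′ m′} (S : Split n (suc k) m) (S′ : Split n (suc k′) m′) {D₁ D₂ D₁′ D₂′} →
  StronglyConnected D₁ → StronglyConnected D₁′ → merge S D₁ D₂ ≡ merge S′ D₁′ D₂′ →
  _≡_ {A = AnySplit n} (suc k , m , S) (suc k′ , m′ , S′)
top-part-unique S S′ D₁-strong D₁′-strong M≡M′ = split-ext S S′ same
  where
  same : ∀ i → isInj₁ (part S i) ≡ isInj₁ (part S′ i)
  same i with part S i in pᵢ | part S′ i in p′ᵢ
  ... | inj₁ _ | inj₁ _ = refl
  ... | inj₂ _ | inj₂ _ = refl
  ... | inj₁ _ | inj₂ _ = ⊥-elim (left⇒¬right S S′ D₁-strong M≡M′ pᵢ p′ᵢ)
  ... | inj₂ _ | inj₁ _ = ⊥-elim (left⇒¬right S′ S D₁′-strong (sym M≡M′) p′ᵢ pᵢ)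

-- The top strong component

ReachesAll : Digraph n → Fin n → Set
ReachesAll D v = ∀ w → Path D v w

Path-restrict-suc : ∀ (D : Digraph (suc n)) {a b} → Path (restrict Fin.suc D) a b → Path D (Fin.suc a) (Fin.suc b)
Path-restrict-suc D = Path-map Fin.suc λ {a} {b} e → trans (sym (adj-restrict Fin.suc D a b)) e

-- Induction on n: a vertex reaching all of 1, …, n reaches 0 too unless 0 beats every other vertex.
tournament-reachesAll : ∀ n (D : Digraph (suc n)) → IsTournament D → Σ[ v ∈ Fin (suc n) ] ReachesAll D v
tournament-reachesAll zero    D T = Fin.zero , λ { Fin.zero → here }
tournament-reachesAll (suc n) D T
  with tournament-reachesAll n (restrict Fin.suc D) (restrict-IsTournament Fin.suc Fin.suc-injective D T)
     | Fin.any? (λ w → adj D (Fin.suc w) Fin.zero Bool.≟ true)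
... | v , v↝ | yes (w , w→0) = Fin.suc v , λ where
  Fin.zero    → Path-restrict-suc D (v↝ w) ++ᵖ step w→0 here
  (Fin.suc u) → Path-restrict-suc D (v↝ u)
... | _ | no ¬w→0 = Fin.zero , λ where
  Fin.zero    → here
  (Fin.suc u) → step (tournament-edge D T (λ ()) (λ u→0 → ¬w→0 (u , u→0))) here

splitBy : ∀ n → (Fin n → Bool) → AnySplit n
splitBy zero    f = 0 , 0 , nil
splitBy (suc n) f = extend (f Fin.zero) (splitBy n (f ∘ Fin.suc))
  where
  extend : Bool → AnySplit n → AnySplit (suc n)
  extend true  (k , m , S) = suc k , m , left S
  extend false (k , m , S) = k , suc m , right S

isInj₁-part-splitBy : ∀ n (f : Fin n → Bool) i → isInj₁ (part (proj₂ (proj₂ (splitBy n f))) i) ≡ f i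
isInj₁-part-splitBy (suc n) f i with f Fin.zero in f₀ | i
... | true  | Fin.zero  = sym f₀
... | false | Fin.zero  = sym f₀
... | true  | Fin.suc j = trans (isInj₁-map₁ Fin.suc _) (isInj₁-part-splitBy n (f ∘ Fin.suc) j)
... | false | Fin.suc j = trans (isInj₁-map₂ Fin.suc _) (isInj₁-part-splitBy n (f ∘ Fin.suc) j)

-- The left part is the top strong component of D.
TopDecomposition : Digraph n → Set
TopDecomposition {n} D = Σ[ k ∈ ℕ ] Σ[ m ∈ ℕ ] Σ[ S ∈ Split n (suc k) m ]
  (merge S (restrict (embedˡ S) D) (restrict (embedʳ S) D) ≡ D) × StronglyConnected (restrict (embedˡ S) D)

module _ (D : Digraph n) (T : IsTournament D) (reaches? : ∀ v → Dec (ReachesAll D v))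
         (S : Split n k m) (S-reaches : ∀ i → isInj₁ (part S i) ≡ isYes (reaches? i)) where

  left-reachesAll : ∀ {i a} → part S i ≡ inj₁ a → ReachesAll D i
  left-reachesAll {i} pᵢ with reaches? i | S-reaches i
  ... | yes i↝ | _ = i↝
  left-reachesAll {i} pᵢ | no _ | eq rewrite pᵢ with eq
  ... | ()

  right-¬reachesAll : ∀ {i b} → part S i ≡ inj₂ b → ¬ ReachesAll D i
  right-¬reachesAll {i} pᵢ with reaches? i | S-reaches i
  ... | no ¬i↝ | _ = ¬i↝
  right-¬reachesAll {i} pᵢ | yes _ | eq rewrite pᵢ with eq
  ... | ()

  private
    mergeAdj-part : ∀ i j → mergeAdj (restrict (embedˡ S) D) (restrict (embedʳ S) D) (part S i) (part S j) ≡ adj D i j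
    mergeAdj-part i j with part S i in pᵢ | part S j in pⱼ
    ... | inj₁ a | inj₁ b = trans (adj-restrict (embedˡ S) D a b) (cong₂ (adj D) (embedˡ-part S pᵢ) (embedˡ-part S pⱼ))
    ... | inj₂ a | inj₂ b = trans (adj-restrict (embedʳ S) D a b) (cong₂ (adj D) (embedʳ-part S pᵢ) (embedʳ-part S pⱼ))
    ... | inj₁ a | inj₂ b = sym (tournament-edge D T (part-≢ S pᵢ pⱼ) λ j→i →
                              right-¬reachesAll pⱼ λ w → step j→i (left-reachesAll pᵢ w))
    ... | inj₂ a | inj₁ b with adj D i j in i→j
    ...   | false = refl
    ...   | true  = ⊥-elim (right-¬reachesAll pᵢ λ w → step i→j (left-reachesAll pⱼ w))

  merge-restrict : merge S (restrict (embedˡ S) D) (restrict (embedʳ S) D) ≡ D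
  merge-restrict = adj-ext λ i j → trans (adj-merge S _ _ refl refl) (mergeAdj-part i j)

  left-strong : StronglyConnected (restrict (embedˡ S) D)
  left-strong a b = Path-merge-within-left S _ _
    (subst (λ M → Path M (embedˡ S a) (embedˡ S b)) (sym merge-restrict) (left-reachesAll (part-embedˡ S a) (embedˡ S b)))
    (part-embedˡ S a) (part-embedˡ S b)

nonempty-topDecomposition : (D : Digraph n) (T : IsTournament D) (reaches? : ∀ v → Dec (ReachesAll D v))
  (S : Split n k m) → (∀ i → isInj₁ (part S i) ≡ isYes (reaches? i)) → Fin k → TopDecomposition D
nonempty-topDecomposition {k = suc k} {m} D T reaches? S S-reaches _ =
  k , m , S , merge-restrict D T reaches? S S-reaches , left-strong D T reaches? S S-reaches

decideTopDecomposition : (D : Digraph (suc n)) → IsTournament D → (∀ v → Dec (ReachesAll D v)) → TopDecomposition D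
decideTopDecomposition {n} D T reaches?
  with splitBy (suc n) (isYes ∘ reaches?) | isInj₁-part-splitBy (suc n) (isYes ∘ reaches?)
... | k , m , S | S-reaches with tournament-reachesAll n D T
...   | v , v↝ with part S v in pᵥ
...     | inj₁ a = nonempty-topDecomposition D T reaches? S S-reaches a
...     | inj₂ b = ⊥-elim (right-¬reachesAll D T reaches? S S-reaches pᵥ v↝)

¬¬-decide : ∀ n (P : Fin n → Set) → ¬ ¬ (∀ i → Dec (P i))
¬¬-decide zero    P ¬dec = ¬dec λ ()
¬¬-decide (suc n) P ¬dec = ¬¬-excluded-middle λ dec₀ → ¬¬-decide n (P ∘ Fin.suc) λ decₛ → ¬dec λ where
  Fin.zero    → dec₀
  (Fin.suc i) → decₛ i

-- Whether a vertex reaches all others is not decided here, so the top decomposition is only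
-- obtained under double negation.
¬¬-topDecomposition : (D : Digraph (suc n)) → IsTournament D → ¬ ¬ TopDecomposition D
¬¬-topDecomposition {n} D T = ¬¬-map (decideTopDecomposition D T) (¬¬-decide (suc n) (ReachesAll D))

-- Counting all tournaments

boolVecs : ∀ n → List (Vec Bool n)
boolVecs zero    = Vec.[] ∷ []
boolVecs (suc n) = map (true Vec.∷_) (boolVecs n) ++ map (false Vec.∷_) (boolVecs n)

boolVecs-complete : (v : Vec Bool n) → v ∈ boolVecs n
boolVecs-complete Vec.[]         = here refl
boolVecs-complete (true Vec.∷ v)  = ∈-++⁺ˡ (∈-map⁺ (true Vec.∷_) (boolVecs-complete v))
boolVecs-complete {suc n} (false Vec.∷ v) = ∈-++⁺ʳ (map (true Vec.∷_) (boolVecs n)) (∈-map⁺ (false Vec.∷_) (boolVecs-complete v))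

boolVecs-unique : ∀ n → Unique (boolVecs n)
boolVecs-unique zero    = All.[] AllPairs.∷ AllPairs.[]
boolVecs-unique (suc n) = ++⁺ (map⁺ Vec.∷-injectiveʳ (boolVecs-unique n)) (map⁺ Vec.∷-injectiveʳ (boolVecs-unique n)) apart
  where
  apart : ∀ {v} → v ∈ map (true Vec.∷_) (boolVecs n) × v ∈ map (false Vec.∷_) (boolVecs n) → ⊥
  apart (v∈ , v∈′) with ∈-map⁻ (true Vec.∷_) v∈ | ∈-map⁻ (false Vec.∷_) v∈′
  ... | _ , _ , refl | _ , _ , ()

trues : Vec Bool n → ℕ
trues {n} v = ∑[ i < n ] (if lookup v i then 1 else 0)

1+u : Poly
1+u = constP 1ℤ +P monomial 1

ΣP-boolVecs : ∀ n → ΣP (boolVecs n) (monomial ∘ trues) ≋ (1+u ^P n)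
ΣP-boolVecs zero    = ≋-refl
ΣP-boolVecs (suc n) = begin
  ΣP (map (true Vec.∷_) (boolVecs n) ++ map (false Vec.∷_) (boolVecs n)) (monomial ∘ trues)
    ≈⟨ ΣP-++ (map (true Vec.∷_) (boolVecs n)) _ (monomial ∘ trues) ⟩
  ΣP (map (true Vec.∷_) (boolVecs n)) (monomial ∘ trues) +P ΣP (map (false Vec.∷_) (boolVecs n)) (monomial ∘ trues)
    ≈⟨ +P-cong (≡⇒≋ (ΣP-map (true Vec.∷_) (boolVecs n) _)) (≡⇒≋ (ΣP-map (false Vec.∷_) (boolVecs n) _)) ⟩
  ΣP (boolVecs n) (λ v → monomial (1 ℕ.+ trues v)) +P X
    ≈⟨ +P-congˡ X (ΣP-cong (boolVecs n) λ v _ → monomial-+ 1 (trues v)) ⟩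
  ΣP (boolVecs n) (λ v → monomial 1 *P monomial (trues v)) +P X
    ≈⟨ +P-congˡ X (*P-distribˡ-ΣP (monomial 1) (boolVecs n) _) ⟨
  (monomial 1 *P X) +P X
    ≈⟨ distrib (monomial 1) X ⟩
  1+u *P X
    ≈⟨ *P-congʳ 1+u (ΣP-boolVecs n) ⟩
  1+u ^P suc n
    ∎
  where
  open ≋-Reasoning
  X = ΣP (boolVecs n) (monomial ∘ trues)
  distrib : ∀ u x → ((u *P x) +P x) ≋ ((constP 1ℤ +P u) *P x)
  distrib = solve-∀ ℤ[u]-solver

addVertexAdj : Vec Bool n → Digraph n → Fin (suc n) → Fin (suc n) → Bool
addVertexAdj v D Fin.zero    Fin.zero    = false
addVertexAdj v D Fin.zero    (Fin.suc j) = not (lookup v j)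
addVertexAdj v D (Fin.suc i) Fin.zero    = lookup v i
addVertexAdj v D (Fin.suc i) (Fin.suc j) = adj D i j

addVertex : Vec Bool n → Digraph n → Digraph (suc n)
addVertex v D = fromAdj (addVertexAdj v D)

addVertex-injective : ∀ {v v′ : Vec Bool n} {D D′} → addVertex v D ≡ addVertex v′ D′ → v ≡ v′ × D ≡ D′
addVertex-injective {v = v} {v′} {D} {D′} eq =
  vec-ext {v = v} {v′} (λ i → adj-at (Fin.suc i) Fin.zero) , adj-ext {D = D} {D′} (λ i j → adj-at (Fin.suc i) (Fin.suc j))
  where
  adj-at : ∀ i j → addVertexAdj v D i j ≡ addVertexAdj v′ D′ i j
  adj-at i j = trans (sym (adj-fromAdj (addVertexAdj v D) i j))
                 (trans (cong (λ M → adj M i j) eq) (adj-fromAdj (addVertexAdj v′ D′) i j))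

addVertex-IsTournament : (v : Vec Bool n) (D : Digraph n) → IsTournament D → IsTournament (addVertex v D)
addVertex-IsTournament v D T = Tournament-adj⇒IsTournament (addVertex v D) (irrefl , flip)
  where
  A = IsTournament⇒Tournament-adj D T
  irrefl : ∀ s → adj (addVertex v D) s s ≡ false
  irrefl s = trans (adj-fromAdj (addVertexAdj v D) s s) (go s)
    where
    go : ∀ s → addVertexAdj v D s s ≡ false
    go Fin.zero    = refl
    go (Fin.suc s) = proj₁ A s
  flip : ∀ s t → s ≢ t → adj (addVertex v D) t s ≡ not (adj (addVertex v D) s t)
  flip s t s≢t = trans (adj-fromAdj (addVertexAdj v D) t s)
    (trans (go s t s≢t) (cong not (sym (adj-fromAdj (addVertexAdj v D) s t))))
    where
    go : ∀ s t → s ≢ t → addVertexAdj v D t s ≡ not (addVertexAdj v D s t)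
    go Fin.zero    Fin.zero    s≢t = ⊥-elim (s≢t refl)
    go Fin.zero    (Fin.suc j) _   = sym (Bool.not-involutive (lookup v j))
    go (Fin.suc i) Fin.zero    _   = refl
    go (Fin.suc i) (Fin.suc j) s≢t = proj₂ A i j (λ i≡j → s≢t (cong Fin.suc i≡j))

column₀ : Digraph (suc n) → Vec Bool n
column₀ D = tabulate λ i → adj D (Fin.suc i) Fin.zero

addVertex-column₀ : (D : Digraph (suc n)) → IsTournament D → addVertex (column₀ D) (restrict Fin.suc D) ≡ D
addVertex-column₀ D T = adj-ext λ i j → trans (adj-fromAdj (addVertexAdj (column₀ D) (restrict Fin.suc D)) i j) (go i j)
  where
  A = IsTournament⇒Tournament-adj D T
  go : ∀ i j → addVertexAdj (column₀ D) (restrict Fin.suc D) i j ≡ adj D i j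
  go Fin.zero    Fin.zero    = sym (proj₁ A Fin.zero)
  go Fin.zero    (Fin.suc j) = trans (cong not (Vec.lookup∘tabulate _ j)) (sym (proj₂ A (Fin.suc j) Fin.zero (λ ())))
  go (Fin.suc i) Fin.zero    = Vec.lookup∘tabulate _ i
  go (Fin.suc i) (Fin.suc j) = adj-restrict Fin.suc D i j

tournaments : ∀ n → List (Digraph n)
tournaments zero    = Vec.[] ∷ []
tournaments (suc n) = concatMap (λ D → map (λ v → addVertex v D) (boolVecs n)) (tournaments n)

tournaments-IsTournament : ∀ n D → D ∈ tournaments n → IsTournament D
tournaments-IsTournament zero    Vec.[] _ = (λ ()) , (λ ()) , (λ ())
tournaments-IsTournament (suc n) D D∈ with ∈-concatMap⁻ (λ D → map (λ v → addVertex v D) (boolVecs n)) (tournaments n) D∈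
... | D′ , D′∈ , D∈′ with ∈-map⁻ (λ v → addVertex v D′) D∈′
...   | v , _ , refl = addVertex-IsTournament v D′ (tournaments-IsTournament n D′ D′∈)

tournaments-complete : ∀ n (D : Digraph n) → IsTournament D → D ∈ tournaments n
tournaments-complete zero    Vec.[] _ = here refl
tournaments-complete (suc n) D T = subst (_∈ tournaments (suc n)) (addVertex-column₀ D T)
  (∈-concatMap⁺ (λ D → map (λ v → addVertex v D) (boolVecs n))
    (tournaments-complete n (restrict Fin.suc D) (restrict-IsTournament Fin.suc Fin.suc-injective D T))
    (∈-map⁺ (λ v → addVertex v (restrict Fin.suc D)) (boolVecs-complete (column₀ D))))

tournaments-unique : ∀ n → Unique (tournaments n)
tournaments-unique zero    = All.[] AllPairs.∷ AllPairs.[]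
tournaments-unique (suc n) = concatMap-Unique _ (tournaments n) (tournaments-unique n)
  (λ D _ → map⁺ (λ {v} {v′} eq → proj₁ (addVertex-injective {v = v} {v′} {D} {D} eq)) (boolVecs-unique n))
  (λ D D′ z _ _ z∈ z∈′ → apart D D′ z z∈ z∈′)
  where
  apart : ∀ D D′ z → z ∈ map (λ v → addVertex v D) (boolVecs n) → z ∈ map (λ v → addVertex v D′) (boolVecs n) → D ≡ D′
  apart D D′ z z∈ z∈′ with ∈-map⁻ (λ v → addVertex v D) z∈ | ∈-map⁻ (λ v → addVertex v D′) z∈′
  ... | v , _ , refl | v′ , _ , eq = proj₂ (addVertex-injective {v = v} {v′} {D} {D′} eq)

des-addVertex : (v : Vec Bool n) (D : Digraph n) → des (addVertex v D) ≡ trues v ℕ.+ des D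
des-addVertex {n} v D = begin
  des M
    ≡⟨ des-∑ M ⟩
  ∑[ t < suc n ] descentAt M Fin.zero t ℕ.+ ∑[ i < n ] (descentAt M (Fin.suc i) Fin.zero ℕ.+ ∑[ j < n ] descentAt M (Fin.suc i) (Fin.suc j))
    ≡⟨ cong₂ ℕ._+_ (trans (sum-cong-≗ row₀) (∑-const-0 (suc n)))
                   (sum-cong-≗ λ i → cong₂ ℕ._+_ (col₀ i) (sum-cong-≗ (inner i))) ⟩
  ∑[ i < n ] ((if lookup v i then 1 else 0) ℕ.+ ∑[ j < n ] descentAt D i j)
    ≡⟨ ∑-distrib-+ (λ i → if lookup v i then 1 else 0) (λ i → ∑[ j < n ] descentAt D i j) ⟩
  trues v ℕ.+ ∑[ i < n ] ∑[ j < n ] descentAt D i j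
    ≡⟨ cong (trues v ℕ.+_) (des-∑ D) ⟨
  trues v ℕ.+ des D
    ∎
  where
  open ≡-Reasoning
  M = addVertex v D
  adjM : ∀ i j → adj M i j ≡ addVertexAdj v D i j
  adjM = adj-fromAdj (addVertexAdj v D)
  row₀ : ∀ t → descentAt M Fin.zero t ≡ 0
  row₀ t rewrite Bool.∧-zeroʳ (adj M Fin.zero t) = refl
  col₀ : ∀ i → descentAt M (Fin.suc i) Fin.zero ≡ (if lookup v i then 1 else 0)
  col₀ i rewrite adjM (Fin.suc i) Fin.zero | Bool.∧-identityʳ (lookup v i) = refl
  inner : ∀ i j → descentAt M (Fin.suc i) (Fin.suc j) ≡ descentAt D i j
  inner i j rewrite adjM (Fin.suc i) (Fin.suc j) = refl

tournamentPoly : ℕ → Poly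
tournamentPoly n = ΣP (tournaments n) (monomial ∘ des)

[n+1]C2 : ∀ n → suc n C 2 ≡ n ℕ.+ n C 2
[n+1]C2 n = trans (sym (nCk+nC[k+1]≡[n+1]C[k+1] n 1)) (cong (ℕ._+ n C 2) (nC1≡n n))

-- Each of the C(n,2) pairs is oriented independently, and a descent costs one factor u.
tournamentPoly-closed : ∀ n → tournamentPoly n ≋ (1+u ^P (n C 2))
tournamentPoly-closed zero    = +P-identityʳ _
tournamentPoly-closed (suc n) = begin
  tournamentPoly (suc n)
    ≈⟨ ΣP-concatMap (λ D → map (λ v → addVertex v D) (boolVecs n)) (tournaments n) _ ⟩
  ΣP (tournaments n) (λ D → ΣP (map (λ v → addVertex v D) (boolVecs n)) (monomial ∘ des))
    ≈⟨ ΣP-cong (tournaments n) (λ D _ → sum-over D) ⟩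
  ΣP (tournaments n) (λ D → V *P monomial (des D))
    ≈⟨ *P-distribˡ-ΣP V (tournaments n) _ ⟨
  V *P tournamentPoly n
    ≈⟨ *P-cong (ΣP-boolVecs n) (tournamentPoly-closed n) ⟩
  (1+u ^P n) *P (1+u ^P (n C 2))
    ≈⟨ ^P-+ 1+u n (n C 2) ⟨
  1+u ^P (n ℕ.+ n C 2)
    ≡⟨ cong (1+u ^P_) ([n+1]C2 n) ⟨
  1+u ^P (suc n C 2)
    ∎
  where
  open ≋-Reasoning
  V = ΣP (boolVecs n) (monomial ∘ trues)
  sum-over : ∀ D → ΣP (map (λ v → addVertex v D) (boolVecs n)) (monomial ∘ des) ≋ (V *P monomial (des D))
  sum-over D = begin
    ΣP (map (λ v → addVertex v D) (boolVecs n)) (monomial ∘ des)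
      ≡⟨ ΣP-map (λ v → addVertex v D) (boolVecs n) (monomial ∘ des) ⟩
    ΣP (boolVecs n) (λ v → monomial (des (addVertex v D)))
      ≈⟨ ΣP-cong (boolVecs n) (λ v _ → ≋-trans (≡⇒≋ (cong monomial (des-addVertex v D))) (monomial-+ (trues v) (des D))) ⟩
    ΣP (boolVecs n) (λ v → monomial (trues v) *P monomial (des D))
      ≈⟨ *P-distribʳ-ΣP (monomial (des D)) (boolVecs n) (monomial ∘ trues) ⟨
    V *P monomial (des D)
      ∎

-- Gaussian binomial coefficients

addLeft : Σ ℕ (Split n k) → Σ ℕ (Split (suc n) (suc k))
addLeft (m , S) = m , left S

addRight : Σ ℕ (Split n k) → Σ ℕ (Split (suc n) k)
addRight (m , S) = suc m , right S

addLeft-injective : Injective _≡_ _≡_ (addLeft {n} {k})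
addLeft-injective refl = refl

addRight-injective : Injective _≡_ _≡_ (addRight {n} {k})
addRight-injective refl = refl

splits : ∀ n k → List (Σ ℕ (Split n k))
splits zero    zero    = (0 , nil) ∷ []
splits zero    (suc k) = []
splits (suc n) zero    = map addRight (splits n zero)
splits (suc n) (suc k) = map addLeft (splits n k) ++ map addRight (splits n (suc k))

splits-complete : (S : Split n k m) → (m , S) ∈ splits n k
splits-complete nil                       = here refl
splits-complete (left S)                  = ∈-++⁺ˡ (∈-map⁺ addLeft (splits-complete S))
splits-complete {k = zero}        (right S) = ∈-map⁺ addRight (splits-complete S)
splits-complete {suc n} {suc k} (right S) = ∈-++⁺ʳ (map addLeft (splits n k)) (∈-map⁺ addRight (splits-complete S))

splits-unique : ∀ n k → Unique (splits n k)
splits-unique zero    zero    = All.[] AllPairs.∷ AllPairs.[]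
splits-unique zero    (suc k) = AllPairs.[]
splits-unique (suc n) zero    = map⁺ addRight-injective (splits-unique n zero)
splits-unique (suc n) (suc k) =
  ++⁺ (map⁺ addLeft-injective (splits-unique n k)) (map⁺ addRight-injective (splits-unique n (suc k))) apart
  where
  apart : ∀ {z} → z ∈ map addLeft (splits n k) × z ∈ map addRight (splits n (suc k)) → ⊥
  apart (z∈ , z∈′) with ∈-map⁻ addLeft z∈ | ∈-map⁻ addRight z∈′
  ... | _ , _ , refl | _ , _ , ()

split-size : Split n k m → k ℕ.+ m ≡ n
split-size nil       = refl
split-size (left S)  = cong suc (split-size S)
split-size {k = k} {suc m} (right S) = trans (ℕ.+-suc k m) (cong suc (split-size S))

split-right-size : Split n k m → m ≡ n ∸ k
split-right-size {k = k} {m} S = trans (sym (ℕ.m+n∸m≡n k m)) (cong (_∸ k) (split-size S))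

split-left-size : Split n k m → k ≤ n
split-left-size {k = k} {m} S = subst (k ≤_) (split-size S) (ℕ.m≤m+n k m)

gaussian : ℕ → ℕ → Poly
gaussian n k = ΣP (splits n k) (monomial ∘ inversions ∘ proj₂)

gaussian-n-0 : ∀ n → gaussian n 0 ≋ 1P
gaussian-n-0 zero    = +P-identityʳ 1P
gaussian-n-0 (suc n) = ≋-trans (≡⇒≋ (ΣP-map addRight (splits n 0) _))
  (≋-trans (ΣP-cong (splits n 0) λ (m , S) _ → ≡⇒≋ (cong monomial (inversions-right S))) (gaussian-n-0 n))

gaussian-suc : ∀ n k → gaussian (suc n) (suc k) ≋ (gaussian n k +P (monomial (suc k) *P gaussian n (suc k)))
gaussian-suc n k = begin
  ΣP (map addLeft (splits n k) ++ map addRight (splits n (suc k))) f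
    ≈⟨ ΣP-++ (map addLeft (splits n k)) _ f ⟩
  ΣP (map addLeft (splits n k)) f +P ΣP (map addRight (splits n (suc k))) f
    ≡⟨ cong₂ _+P_ (ΣP-map addLeft (splits n k) f) (ΣP-map addRight (splits n (suc k)) f) ⟩
  ΣP (splits n k) (f ∘ addLeft) +P ΣP (splits n (suc k)) (f ∘ addRight)
    ≈⟨ +P-cong (ΣP-cong (splits n k) λ (m , S) _ → ≡⇒≋ (cong monomial (inversions-left S)))
               (ΣP-cong (splits n (suc k)) λ (m , S) _ →
                  ≋-trans (≡⇒≋ (cong monomial (inversions-right S))) (monomial-+ (suc k) (inversions S))) ⟩
  gaussian n k +P ΣP (splits n (suc k)) (λ (m , S) → monomial (suc k) *P monomial (inversions S))
    ≈⟨ +P-congʳ (gaussian n k) (*P-distribˡ-ΣP (monomial (suc k)) (splits n (suc k)) _) ⟨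
  gaussian n k +P (monomial (suc k) *P gaussian n (suc k))
    ∎
  where
  open ≋-Reasoning
  f : Σ ℕ (Split (suc n) (suc k)) → Poly
  f = monomial ∘ inversions ∘ proj₂

gaussian-beyond : ∀ n k → n ≤ k → gaussian n (suc k) ≋ []
gaussian-beyond zero    k       _         = ≋-refl
gaussian-beyond (suc n) (suc k) (s≤s n≤k) = begin
  gaussian (suc n) (suc (suc k))
    ≈⟨ gaussian-suc n (suc k) ⟩
  gaussian n (suc k) +P (monomial (suc (suc k)) *P gaussian n (suc (suc k)))
    ≈⟨ +P-cong (gaussian-beyond n k n≤k) (*P-congʳ (monomial (suc (suc k))) (gaussian-beyond n (suc k) (ℕ.m≤n⇒m≤1+n n≤k))) ⟩
  [] +P (monomial (suc (suc k)) *P [])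
    ≈⟨ *P-zeroʳ (monomial (suc (suc k))) ⟩
  []
    ∎
  where open ≋-Reasoning

uInt-+ : ∀ a b → uInt (a ℕ.+ b) ≋ (uInt a +P (monomial a *P uInt b))
uInt-+ zero    b = ≋-sym (*P-identityˡ (uInt b))
uInt-+ (suc a) b = ≋-trans (∷-cong (sym (ℤ.+-identityʳ 1ℤ)) (uInt-+ a b))
  (+P-congʳ (uInt (suc a)) (≋-sym (0∷-*P (monomial a) (uInt b))))

coeff₀-!u : ∀ n → coeff (n !u) 0 ≡ 1ℤ
coeff₀-!u zero    = refl
coeff₀-!u (suc n) = trans (coeff₀-*P (uInt (suc n)) (n !u)) (trans (cong (1ℤ ℤ.*_) (coeff₀-!u n)) refl)

-- The q-analogue of n! = C(n,k) k! (n-k)!, by induction via gaussian-suc and [n+1] = [k+1] + u^(k+1) [n-k].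
gaussian-!u : ∀ n k → k ≤ n → (gaussian n k *P ((k !u) *P ((n ∸ k) !u))) ≋ (n !u)
gaussian-!u n       zero    _         = ≋-trans (*P-congˡ _ (gaussian-n-0 n)) (≋-trans (*P-identityˡ _) (*P-identityˡ _))
gaussian-!u (suc n) (suc k) (s≤s k≤n) = begin
  gaussian (suc n) (suc k) *P F
    ≈⟨ *P-congˡ F (gaussian-suc n k) ⟩
  (gaussian n k +P (monomial (suc k) *P gaussian n (suc k))) *P F
    ≈⟨ distribute (gaussian n k) (monomial (suc k)) (gaussian n (suc k)) F ⟩
  (gaussian n k *P F) +P (monomial (suc k) *P (gaussian n (suc k) *P F))
    ≈⟨ +P-cong left-term (*P-congʳ (monomial (suc k)) right-term) ⟩
  (uInt (suc k) *P (n !u)) +P (monomial (suc k) *P (uInt (n ∸ k) *P (n !u)))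
    ≈⟨ collect (uInt (suc k)) (monomial (suc k)) (uInt (n ∸ k)) (n !u) ⟩
  (uInt (suc k) +P (monomial (suc k) *P uInt (n ∸ k))) *P (n !u)
    ≈⟨ *P-congˡ (n !u) (uInt-+ (suc k) (n ∸ k)) ⟨
  uInt (suc k ℕ.+ (n ∸ k)) *P (n !u)
    ≡⟨ cong (λ j → uInt (suc j) *P (n !u)) (ℕ.m+[n∸m]≡n k≤n) ⟩
  suc n !u
    ∎
  where
  open ≋-Reasoning
  F = (suc k !u) *P ((n ∸ k) !u)
  distribute : ∀ a b c F → ((a +P (b *P c)) *P F) ≋ ((a *P F) +P (b *P (c *P F)))
  distribute = solve-∀ ℤ[u]-solver
  collect : ∀ a b c N → ((a *P N) +P (b *P (c *P N))) ≋ ((a +P (b *P c)) *P N)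
  collect = solve-∀ ℤ[u]-solver
  regroup : ∀ g a b c → (g *P ((a *P b) *P c)) ≋ (a *P (g *P (b *P c)))
  regroup = solve-∀ ℤ[u]-solver
  left-term : (gaussian n k *P F) ≋ (uInt (suc k) *P (n !u))
  left-term = ≋-trans (regroup (gaussian n k) (uInt (suc k)) (k !u) ((n ∸ k) !u))
                      (*P-congʳ (uInt (suc k)) (gaussian-!u n k k≤n))
  right-term : (gaussian n (suc k) *P F) ≋ (uInt (n ∸ k) *P (n !u))
  right-term with ℕ.m≤n⇒m<n∨m≡n k≤n
  ... | inj₂ refl = ≋-trans (*P-congˡ F (gaussian-beyond n n ℕ.≤-refl)) (≡⇒≋ (cong (λ j → uInt j *P (n !u)) (sym (ℕ.n∸n≡0 n))))
  ... | inj₁ k<n rewrite ℕ.+-∸-assoc 1 k<n = ≋-trans (regroup′ (gaussian n (suc k)) (uInt (suc k)) (k !u) (uInt (suc (n ∸ suc k))) ((n ∸ suc k) !u))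
                                          (*P-congʳ (uInt (suc (n ∸ suc k))) (gaussian-!u n (suc k) k<n))
    where
    regroup′ : ∀ g a b c d → (g *P ((a *P b) *P (c *P d))) ≋ (c *P (g *P ((a *P b) *P d)))
    regroup′ = solve-∀ ℤ[u]-solver

gaussian-symmetric : ∀ n k → k ≤ n → gaussian n (n ∸ k) ≋ gaussian n k
gaussian-symmetric n k k≤n = *P-cancelˡ F _ _ F₀≡1 (begin
  F *P gaussian n (n ∸ k)
    ≈⟨ *P-comm F (gaussian n (n ∸ k)) ⟩
  gaussian n (n ∸ k) *P ((k !u) *P ((n ∸ k) !u))
    ≈⟨ *P-congʳ (gaussian n (n ∸ k)) (*P-comm (k !u) ((n ∸ k) !u)) ⟩
  gaussian n (n ∸ k) *P (((n ∸ k) !u) *P (k !u))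
    ≡⟨ cong (λ j → gaussian n (n ∸ k) *P (((n ∸ k) !u) *P (j !u))) (ℕ.m∸[m∸n]≡n k≤n) ⟨
  gaussian n (n ∸ k) *P (((n ∸ k) !u) *P ((n ∸ (n ∸ k)) !u))
    ≈⟨ gaussian-!u n (n ∸ k) (ℕ.m∸n≤m n k) ⟩
  n !u
    ≈⟨ gaussian-!u n k k≤n ⟨
  gaussian n k *P F
    ≈⟨ *P-comm (gaussian n k) F ⟩
  F *P gaussian n k
    ∎)
  where
  open ≋-Reasoning
  F = (k !u) *P ((n ∸ k) !u)
  F₀≡1 : coeff F 0 ≡ 1ℤ
  F₀≡1 = trans (coeff₀-*P (k !u) ((n ∸ k) !u)) (cong₂ ℤ._*_ (coeff₀-!u k) (coeff₀-!u (n ∸ k)))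

-- Sorting tournaments by their top strong component

↭-unique : ∀ {A : Set} {xs ys : List A} → Unique xs → Unique ys → (∀ {x} → x ∈ xs → x ∈ ys) → (∀ {x} → x ∈ ys → x ∈ xs) → xs ↭ ys
↭-unique xs! ys! xs⊆ys ys⊆xs = ∼bag⇒↭ (unique∧set⇒bag xs! ys! (mk⇔ xs⊆ys ys⊆xs))

_≟ᴰ_ : (D D′ : Digraph n) → Dec (D ≡ D′)
_≟ᴰ_ = Vec.≡-dec (Vec.≡-dec Bool._≟_)

module TopDecompositions (L : (n : ℕ) → List (Digraph n)) (enumerates : EnumeratesSCT L) where

  L-strong : ∀ {k} {D : Digraph k} → D ∈ L k → IsTournament D × StronglyConnected D
  L-strong {k} {D} = Equivalence.to (proj₂ enumerates k D)

  L-complete : ∀ {k} {D : Digraph k} → IsTournament D → StronglyConnected D → D ∈ L k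
  L-complete {k} {D} T strong = Equivalence.from (proj₂ enumerates k D) (T , strong)

  mergesAlong : ∀ {k} → Σ ℕ (Split n k) → List (Digraph n)
  mergesAlong {k = k} (m , S) = concatMap (λ D₁ → map (merge S D₁) (tournaments m)) (L k)

  -- All tournaments on n vertices whose top strong component has k + 1 vertices.
  withTopSize : ∀ n → ℕ → List (Digraph n)
  withTopSize n k = concatMap mergesAlong (splits n (suc k))

  byTopSize : ∀ n → List (Digraph n)
  byTopSize n = concatMap (withTopSize n) (upTo n)

  record MergeOf {n k m} (S : Split n k m) (z : Digraph n) : Set where
    field
      {top}   : Digraph k
      {rest}  : Digraph m
      top∈L   : top ∈ L k
      rest∈   : rest ∈ tournaments m
      z≡merge : z ≡ merge S top rest

  ∈-mergesAlong⁻ : ∀ {k m} (S : Split n k m) {z} → z ∈ mergesAlong (m , S) → MergeOf S z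
  ∈-mergesAlong⁻ {k = k} {m} S z∈ with ∈-concatMap⁻ (λ D₁ → map (merge S D₁) (tournaments m)) (L k) z∈
  ... | D₁ , D₁∈ , z∈′ with ∈-map⁻ (merge S D₁) z∈′
  ...   | D₂ , D₂∈ , z≡ = record { top∈L = D₁∈ ; rest∈ = D₂∈ ; z≡merge = z≡ }

  ∈-withTopSize⁻ : ∀ {k z} → z ∈ withTopSize n k → Σ[ m ∈ ℕ ] Σ[ S ∈ Split n (suc k) m ] MergeOf S z
  ∈-withTopSize⁻ {n} {k} z∈ with ∈-concatMap⁻ mergesAlong (splits n (suc k)) z∈
  ... | (m , S) , _ , z∈′ = m , S , ∈-mergesAlong⁻ S z∈′

  MergeOf-unique : ∀ {k k′ m m′ z} {S : Split n (suc k) m} {S′ : Split n (suc k′) m′} → MergeOf S z → MergeOf S′ z →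
    _≡_ {A = AnySplit n} (suc k , m , S) (suc k′ , m′ , S′)
  MergeOf-unique {S = S} {S′} M M′ = top-part-unique S S′
    (proj₂ (L-strong (MergeOf.top∈L M))) (proj₂ (L-strong (MergeOf.top∈L M′)))
    (trans (sym (MergeOf.z≡merge M)) (MergeOf.z≡merge M′))

  mergesAlong-unique : ∀ {k m} (S : Split n k m) → Unique (mergesAlong (m , S))
  mergesAlong-unique {k = k} {m} S = concatMap-Unique _ (L k) (proj₁ enumerates k)
    (λ D₁ _ → map⁺ (λ {D₂} {D₂′} eq → trans (sym (restrict-merge-embedʳ S D₁ D₂))
                                         (trans (cong (restrict (embedʳ S)) eq) (restrict-merge-embedʳ S D₁ D₂′)))
                   (tournaments-unique m))
    λ D₁ D₁′ z _ _ z∈ z∈′ → top-determined D₁ D₁′ z∈ z∈′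
    where
    top-determined : ∀ D₁ D₁′ {z} → z ∈ map (merge S D₁) (tournaments m) → z ∈ map (merge S D₁′) (tournaments m) → D₁ ≡ D₁′
    top-determined D₁ D₁′ z∈ z∈′ with ∈-map⁻ (merge S D₁) z∈ | ∈-map⁻ (merge S D₁′) z∈′
    ... | D₂ , _ , refl | D₂′ , _ , eq = trans (sym (restrict-merge-embedˡ S D₁ D₂))
                                           (trans (cong (restrict (embedˡ S)) eq) (restrict-merge-embedˡ S D₁′ D₂′))

  withTopSize-unique : ∀ n k → Unique (withTopSize n k)
  withTopSize-unique n k = concatMap-Unique mergesAlong (splits n (suc k)) (splits-unique n (suc k))
    (λ (m , S) _ → mergesAlong-unique S)
    λ (m , S) (m′ , S′) z _ _ z∈ z∈′ → split-determined (MergeOf-unique (∈-mergesAlong⁻ S z∈) (∈-mergesAlong⁻ S′ z∈′))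
    where
    split-determined : ∀ {m m′} {S : Split n (suc k) m} {S′ : Split n (suc k) m′} →
      _≡_ {A = AnySplit n} (suc k , m , S) (suc k , m′ , S′) → (m , S) ≡ (m′ , S′)
    split-determined refl = refl

  byTopSize-unique : ∀ n → Unique (byTopSize n)
  byTopSize-unique n = concatMap-Unique (withTopSize n) (upTo n) (upTo⁺ n) (λ k _ → withTopSize-unique n k)
    λ k k′ z _ _ z∈ z∈′ → top-size-determined (∈-withTopSize⁻ z∈) (∈-withTopSize⁻ z∈′)
    where
    top-size-determined : ∀ {k k′ z} → Σ[ m ∈ ℕ ] Σ[ S ∈ Split n (suc k) m ] MergeOf S z →
      Σ[ m ∈ ℕ ] Σ[ S ∈ Split n (suc k′) m ] MergeOf S z → k ≡ k′
    top-size-determined (_ , _ , M) (_ , _ , M′) = ℕ.suc-injective (cong proj₁ (MergeOf-unique M M′))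

  byTopSize-IsTournament : ∀ {n} D → D ∈ byTopSize n → IsTournament D
  byTopSize-IsTournament {n} D D∈ with ∈-concatMap⁻ (withTopSize n) (upTo n) D∈
  ... | k , _ , D∈′ with ∈-withTopSize⁻ D∈′
  ...   | m , S , record { top∈L = top∈L ; rest∈ = rest∈ ; z≡merge = refl } =
    merge-IsTournament S _ _ (proj₁ (L-strong top∈L)) (tournaments-IsTournament m _ rest∈)


  TopDecomposition⇒∈ : (D : Digraph n) → IsTournament D → TopDecomposition D → D ∈ byTopSize n
  TopDecomposition⇒∈ {n} D T (k , m , S , merge≡D , strong) = subst (_∈ byTopSize n) merge≡D
    (∈-concatMap⁺ (withTopSize n) (∈-upTo⁺ (split-left-size S))
      (∈-concatMap⁺ mergesAlong (splits-complete S)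
        (∈-concatMap⁺ (λ D₁ → map (merge S D₁) (tournaments m)) (L-complete (restrict-IsTournament (embedˡ S) (embedˡ-injective S) D T) strong)
          (∈-map⁺ (merge S _) (tournaments-complete m _ (restrict-IsTournament (embedʳ S) (embedʳ-injective S) D T))))))

  -- Membership in a list is decidable, so the double negation can be discharged.
  byTopSize-complete : (D : Digraph (suc n)) → IsTournament D → D ∈ byTopSize (suc n)
  byTopSize-complete {n} D T with DecMembership._∈?_ _≟ᴰ_ D (byTopSize (suc n))
  ... | yes D∈ = D∈
  ... | no D∉  = ⊥-elim (¬¬-topDecomposition D T (D∉ ∘ TopDecomposition⇒∈ D T))

  tournaments↭byTopSize : ∀ n → tournaments (suc n) ↭ byTopSize (suc n)
  tournaments↭byTopSize n = ↭-unique (tournaments-unique (suc n)) (byTopSize-unique (suc n))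
    (λ {D} D∈ → byTopSize-complete D (tournaments-IsTournament (suc n) D D∈))
    (λ {D} D∈ → tournaments-complete (suc n) D (byTopSize-IsTournament D D∈))

  ΣP-mergesAlong : ∀ {k m} (S : Split n k m) →
    ΣP (mergesAlong (m , S)) (monomial ∘ des) ≋ (monomial (inversions S) *P (tpoly (L k) *P tournamentPoly m))
  ΣP-mergesAlong {k = k} {m} S = begin
    ΣP (mergesAlong (m , S)) (monomial ∘ des)
      ≈⟨ ΣP-concatMap _ (L k) (monomial ∘ des) ⟩
    ΣP (L k) (λ D₁ → ΣP (map (merge S D₁) (tournaments m)) (monomial ∘ des))
      ≈⟨ ΣP-cong (L k) (λ D₁ _ → ≡⇒≋ (ΣP-map (merge S D₁) (tournaments m) (monomial ∘ des))) ⟩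
    ΣP (L k) (λ D₁ → ΣP (tournaments m) (λ D₂ → monomial (des (merge S D₁ D₂))))
      ≈⟨ ΣP-cong (L k) (λ D₁ _ → ΣP-cong (tournaments m) λ D₂ _ → monomial-des-merge D₁ D₂) ⟩
    ΣP (L k) (λ D₁ → ΣP (tournaments m) (λ D₂ → I *P (monomial (des D₁) *P monomial (des D₂))))
      ≈⟨ ΣP-cong (L k) (λ D₁ _ → ≋-trans (*P-congʳ I (*P-distribˡ-ΣP (monomial (des D₁)) (tournaments m) _)) (*P-distribˡ-ΣP I (tournaments m) _)) ⟨
    ΣP (L k) (λ D₁ → I *P (monomial (des D₁) *P tournamentPoly m))
      ≈⟨ ≋-trans (*P-congʳ I (*P-distribʳ-ΣP (tournamentPoly m) (L k) (monomial ∘ des))) (*P-distribˡ-ΣP I (L k) _) ⟨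
    I *P (tpoly (L k) *P tournamentPoly m)
      ∎
    where
    open ≋-Reasoning
    I = monomial (inversions S)
    rotate : ∀ a b c → ((a *P b) *P c) ≋ (c *P (a *P b))
    rotate = solve-∀ ℤ[u]-solver
    monomial-des-merge : ∀ D₁ D₂ → monomial (des (merge S D₁ D₂)) ≋ (I *P (monomial (des D₁) *P monomial (des D₂)))
    monomial-des-merge D₁ D₂ = ≋-trans (≡⇒≋ (cong monomial (des-merge S D₁ D₂)))
      (≋-trans (monomial-+ (des D₁ ℕ.+ des D₂) (inversions S))
        (≋-trans (*P-congˡ I (monomial-+ (des D₁) (des D₂))) (rotate (monomial (des D₁)) (monomial (des D₂)) I)))

  ΣP-withTopSize : ∀ n k → ΣP (withTopSize n k) (monomial ∘ des) ≋ (gaussian n (suc k) *P (tpoly (L (suc k)) *P tournamentPoly (n ∸ suc k)))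
  ΣP-withTopSize n k = begin
    ΣP (withTopSize n k) (monomial ∘ des)
      ≈⟨ ΣP-concatMap mergesAlong (splits n (suc k)) (monomial ∘ des) ⟩
    ΣP (splits n (suc k)) (λ x → ΣP (mergesAlong x) (monomial ∘ des))
      ≈⟨ ΣP-cong (splits n (suc k)) (λ x _ → ≋-trans (ΣP-mergesAlong (proj₂ x))
           (*P-congʳ (monomial (inversions (proj₂ x)))
             (*P-congʳ (tpoly (L (suc k))) (≡⇒≋ (cong tournamentPoly (split-right-size (proj₂ x))))))) ⟩
    ΣP (splits n (suc k)) (λ x → monomial (inversions (proj₂ x)) *P R)
      ≈⟨ *P-distribʳ-ΣP R (splits n (suc k)) _ ⟨
    gaussian n (suc k) *P R
      ∎
    where
    open ≋-Reasoning
    R = tpoly (L (suc k)) *P tournamentPoly (n ∸ suc k)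

  -- Sort the tournaments on n + 1 vertices by their top strong component.
  tournamentPoly-recursion : ∀ n →
    tournamentPoly (suc n) ≋ ΣP (upTo (suc n)) (λ k → gaussian (suc n) (suc k) *P (tpoly (L (suc k)) *P tournamentPoly (n ∸ k)))
  tournamentPoly-recursion n =
    ≋-trans (ΣP-↭ (monomial ∘ des) (tournaments↭byTopSize n))
      (≋-trans (ΣP-concatMap (withTopSize (suc n)) (upTo (suc n)) (monomial ∘ des))
        (ΣP-cong (upTo (suc n)) λ k _ → ΣP-withTopSize (suc n) k))

-- The series identities

ΣP-upTo-suc : ∀ m (h : ℕ → Poly) → ΣP (upTo (suc m)) h ≋ (h 0 +P ΣP (upTo m) (h ∘ suc))
ΣP-upTo-suc m h = +P-congʳ (h 0) (≡⇒≋ (trans (cong (λ ks → ΣP ks h) (sym (List.map-upTo suc m))) (ΣP-map suc (upTo m) h)))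

ΣP-upTo-snoc : ∀ m (h : ℕ → Poly) → ΣP (upTo (suc m)) h ≋ (ΣP (upTo m) h +P h m)
ΣP-upTo-snoc m h = ≋-trans (≡⇒≋ (cong (λ ks → ΣP ks h) (sym (List.upTo-∷ʳ m))))
  (≋-trans (ΣP-++ (upTo m) (m ∷ []) h) (+P-congʳ (ΣP (upTo m) h) (+P-identityʳ (h m))))

ΣP-upTo-reverse : ∀ m (h : ℕ → Poly) → ΣP (upTo m) h ≋ ΣP (upTo m) (λ k → h (m ∸ suc k))
ΣP-upTo-reverse zero    h = ≋-refl
ΣP-upTo-reverse (suc m) h = begin
  ΣP (upTo (suc m)) h                             ≈⟨ ΣP-upTo-suc m h ⟩
  h 0 +P ΣP (upTo m) (h ∘ suc)                    ≈⟨ +P-congʳ (h 0) (ΣP-upTo-reverse m (h ∘ suc)) ⟩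
  h 0 +P ΣP (upTo m) (λ k → h (suc (m ∸ suc k)))  ≈⟨ +P-congʳ (h 0) (ΣP-cong (upTo m) λ k k∈ → ≡⇒≋ (cong h (sym (ℕ.+-∸-assoc 1 (∈-upTo⁻ k∈))))) ⟩
  h 0 +P ΣP (upTo m) (λ k → h (m ∸ k))            ≈⟨ +P-comm (h 0) _ ⟩
  ΣP (upTo m) (λ k → h (m ∸ k)) +P h 0            ≡⟨ cong (λ j → ΣP (upTo m) (λ k → h (m ∸ k)) +P h j) (ℕ.n∸n≡0 m) ⟨
  ΣP (upTo m) (λ k → h (m ∸ k)) +P h (m ∸ m)      ≈⟨ ΣP-upTo-snoc m (λ k → h (m ∸ k)) ⟨
  ΣP (upTo (suc m)) (λ k → h (suc m ∸ suc k))     ∎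
  where open ≋-Reasoning

-- The hypothesis says that g k = c k / N in ℚ(u).
sumF-commonDenominator : ∀ (ks : List ℕ) (g : ℕ → Frac) (c : ℕ → Poly) N →
  (∀ k → k ∈ ks → (num (g k) *P N) ≋ (c k *P den (g k))) →
  (num (sumF (map g ks)) *P N) ≋ (ΣP ks c *P den (sumF (map g ks)))
sumF-commonDenominator []       g c N g≈c/N = ≋-refl
sumF-commonDenominator (k ∷ ks) g c N g≈c/N = begin
  ((a *P d) +P (a′ *P b)) *P N      ≈⟨ expand a d a′ b N ⟩
  ((a *P N) *P d) +P ((a′ *P N) *P b) ≈⟨ +P-cong (*P-congˡ d (g≈c/N k (here refl)))
                                               (*P-congˡ b (sumF-commonDenominator ks g c N λ k′ k′∈ → g≈c/N k′ (there k′∈))) ⟩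
  ((c k *P b) *P d) +P ((ΣP ks c *P d) *P b) ≈⟨ collect (c k) b d (ΣP ks c) ⟩
  (c k +P ΣP ks c) *P (b *P d)      ∎
  where
  open ≋-Reasoning
  a = num (g k)
  b = den (g k)
  a′ = num (sumF (map g ks))
  d = den (sumF (map g ks))
  expand : ∀ a d a′ b N → (((a *P d) +P (a′ *P b)) *P N) ≋ (((a *P N) *P d) +P ((a′ *P N) *P b))
  expand = solve-∀ ℤ[u]-solver
  collect : ∀ c b d s → (((c *P b) *P d) +P ((s *P d) *P b)) ≋ ((c +P s) *P (b *P d))
  collect = solve-∀ ℤ[u]-solver

sumF-≈F-0F : ∀ (ks : List ℕ) (g : ℕ → Frac) (c : ℕ → Poly) N → coeff N 0 ≡ 1ℤ →
  (∀ k → k ∈ ks → (num (g k) *P N) ≋ (c k *P den (g k))) → ΣP ks c ≋ [] → sumF (map g ks) ≈F 0F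
sumF-≈F-0F ks g c N N₀≡1 g≈c/N Σc≋[] = coeff-≡ (≋-trans (*P-identityʳ _) num≋[])
  where
  num≋[] : num (sumF (map g ks)) ≋ []
  num≋[] = *P-cancelˡ-[] N _ N₀≡1 (≋-trans (*P-comm N _)
    (≋-trans (sumF-commonDenominator ks g c N g≈c/N) (*P-congˡ _ Σc≋[])))

-- The Cauchy product of a/k!_u and b/(n-k)!_u, written over n!_u.
*F-over-!u : ∀ n k → k ≤ n → ∀ (a b : Frac) p q →
  (num a *P (k !u)) ≋ (p *P den a) → (num b *P ((n ∸ k) !u)) ≋ (q *P den b) →
  (num (a *F b) *P (n !u)) ≋ ((gaussian n k *P (p *P q)) *P den (a *F b))
*F-over-!u n k k≤n a b p q a≈p/k! b≈q/[n-k]! = begin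
  (num a *P num b) *P (n !u)
    ≈⟨ *P-congʳ (num a *P num b) (gaussian-!u n k k≤n) ⟨
  (num a *P num b) *P (gaussian n k *P ((k !u) *P ((n ∸ k) !u)))
    ≈⟨ regroup (num a) (num b) (gaussian n k) (k !u) ((n ∸ k) !u) ⟩
  gaussian n k *P ((num a *P (k !u)) *P (num b *P ((n ∸ k) !u)))
    ≈⟨ *P-congʳ (gaussian n k) (*P-cong a≈p/k! b≈q/[n-k]!) ⟩
  gaussian n k *P ((p *P den a) *P (q *P den b))
    ≈⟨ regroup′ (gaussian n k) p (den a) q (den b) ⟩
  (gaussian n k *P (p *P q)) *P (den a *P den b)
    ∎
  where
  open ≋-Reasoning
  regroup : ∀ x y g f f′ → ((x *P y) *P (g *P (f *P f′))) ≋ (g *P ((x *P f) *P (y *P f′)))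
  regroup = solve-∀ ℤ[u]-solver
  regroup′ : ∀ g p d q e → (g *P ((p *P d) *P (q *P e))) ≋ ((g *P (p *P q)) *P (d *P e))
  regroup′ = solve-∀ ℤ[u]-solver

module Inverse (L : (n : ℕ) → List (Digraph n)) (enumerates : EnumeratesSCT L) where

  open TopDecompositions L enumerates

  -- k!_u times the k-th coefficient of 1 - T.
  1-t : ℕ → Poly
  1-t zero    = 1P
  1-t (suc k) = -P tpoly (L (suc k))

  num-1-T : ∀ k → (num ((1S -S T L) k) *P (k !u)) ≋ (1-t k *P den ((1S -S T L) k))
  num-1-T zero    = ≋-refl
  num-1-T (suc k) = *P-assoc (-P tpoly (L (suc k))) 1P (suc k !u)

  num-U : ∀ k → (num (U k) *P (k !u)) ≋ (tournamentPoly k *P den (U k))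
  num-U k = *P-congˡ (k !u) (≋-sym (tournamentPoly-closed k))

  convolution : ∀ n → ΣP (upTo (suc (suc n))) (λ k → gaussian (suc n) k *P (1-t k *P tournamentPoly (suc n ∸ k))) ≋ []
  convolution n = begin
    ΣP (upTo (suc (suc n))) h
      ≈⟨ ΣP-upTo-suc (suc n) h ⟩
    h 0 +P ΣP (upTo (suc n)) (h ∘ suc)
      ≈⟨ +P-cong h₀ (ΣP-cong (upTo (suc n)) λ k _ → negate (gaussian (suc n) (suc k)) (tpoly (L (suc k))) (tournamentPoly (n ∸ k))) ⟩
    tournamentPoly (suc n) +P ΣP (upTo (suc n)) (λ k → -P P k)
      ≈⟨ +P-cong (tournamentPoly-recursion n) (-P-ΣP (upTo (suc n)) P) ⟩
    ΣP (upTo (suc n)) P +P (-P ΣP (upTo (suc n)) P)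
      ≈⟨ -P-inverseʳ (ΣP (upTo (suc n)) P) ⟩
    []
      ∎
    where
    open ≋-Reasoning
    h : ℕ → Poly
    h k = gaussian (suc n) k *P (1-t k *P tournamentPoly (suc n ∸ k))
    P : ℕ → Poly
    P k = gaussian (suc n) (suc k) *P (tpoly (L (suc k)) *P tournamentPoly (n ∸ k))
    h₀ : h 0 ≋ tournamentPoly (suc n)
    h₀ = ≋-trans (*P-congˡ _ (gaussian-n-0 (suc n))) (≋-trans (*P-identityˡ _) (*P-identityˡ _))
    negate : ∀ g t w → (g *P ((-P t) *P w)) ≋ (-P (g *P (t *P w)))
    negate = solve-∀ ℤ[u]-solver

  convolution-reversed : ∀ n → ΣP (upTo (suc (suc n))) (λ k → gaussian (suc n) k *P (tournamentPoly k *P 1-t (suc n ∸ k))) ≋ []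
  convolution-reversed n = ≋-trans (ΣP-upTo-reverse (suc (suc n)) λ k → gaussian (suc n) k *P (tournamentPoly k *P 1-t (suc n ∸ k))) (≋-trans (ΣP-cong (upTo (suc (suc n))) reflect) (convolution n))
    where
    reflect : ∀ k → k ∈ upTo (suc (suc n)) →
      (gaussian (suc n) (suc n ∸ k) *P (tournamentPoly (suc n ∸ k) *P 1-t (suc n ∸ (suc n ∸ k))))
        ≋ (gaussian (suc n) k *P (1-t k *P tournamentPoly (suc n ∸ k)))
    reflect k k∈ = *P-cong (gaussian-symmetric (suc n) k k≤)
      (≋-trans (*P-comm (tournamentPoly (suc n ∸ k)) _) (*P-congˡ _ (≡⇒≋ (cong 1-t (ℕ.m∸[m∸n]≡n k≤)))))
      where k≤ = ℕ.≤-pred (∈-upTo⁻ k∈)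

  [1-T]*U≈1 : ((1S -S T L) *S U) ≈S 1S
  [1-T]*U≈1 zero    = λ _ → refl
  [1-T]*U≈1 (suc n) = sumF-≈F-0F (upTo (suc (suc n))) (λ k → (1S -S T L) k *F U (suc n ∸ k))
    (λ k → gaussian (suc n) k *P (1-t k *P tournamentPoly (suc n ∸ k))) (suc n !u) (coeff₀-!u (suc n))
    (λ k k∈ → *F-over-!u (suc n) k (ℕ.≤-pred (∈-upTo⁻ k∈)) ((1S -S T L) k) (U (suc n ∸ k)) (1-t k) (tournamentPoly (suc n ∸ k))
       (num-1-T k) (num-U (suc n ∸ k)))
    (convolution n)

  U*[1-T]≈1 : (U *S (1S -S T L)) ≈S 1S
  U*[1-T]≈1 zero    = λ _ → refl
  U*[1-T]≈1 (suc n) = sumF-≈F-0F (upTo (suc (suc n))) (λ k → U k *F (1S -S T L) (suc n ∸ k))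
    (λ k → gaussian (suc n) k *P (tournamentPoly k *P 1-t (suc n ∸ k))) (suc n !u) (coeff₀-!u (suc n))
    (λ k k∈ → *F-over-!u (suc n) k (ℕ.≤-pred (∈-upTo⁻ k∈)) (U k) ((1S -S T L) (suc n ∸ k)) (tournamentPoly k) (1-t (suc n ∸ k))
       (num-U k) (num-1-T (suc n ∸ k)))
    (convolution-reversed n)

corollary3p4 : (L : (n : ℕ) → List (Digraph n)) → EnumeratesSCT L →
    IsInverse U (1S -S T L) × IsInverse (1S -S T L) U
corollary3p4 L enumerates = (U*[1-T]≈1 , [1-T]*U≈1) , ([1-T]*U≈1 , U*[1-T]≈1)
  where open Inverse L enumerates
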